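{- Let $k\geq 0$ and $d\geq 1$ be integers. A vector $\mathfrak{c}=(c_1,\ldots,c_d)\in\mathbb{N}^d$ is the clique vector of a $k$-connected chordal graph if and only if the vector $\mathfrak{b}=(b_1,\ldots,b_d)$ defined by \[ \sum_{i=1}^d b_i x^{i-1}=\sum_{i=1}^d c_i (x-1)^{i-1} \] has positive components and $b_1=b_2=\cdots=b_k=1$.
   Context: All graphs are finite and simple. A clique of a graph $G$ is a set of pairwise adjacent vertices. The clique vector $\mathfrak{c}(G)$ of $G$ is $(c_1,\ldots,c_d)\in\mathbb{N}^d$, where $c_i$ is the number of cliques of $G$ with $i$ vertices and $d$ is the largest cardinality of a clique in $G$. A graph is chordal if every cycle of length at least $4$ has a chord. A graph $G$ is $k$-connected (for $k\geq 1$) if it has at least $k$ vertices and removing any set of fewer than $k$ vertices yields a connected graph; by convention every graph is $0$-connected. For $k=0$ the condition $b_1=\cdots=b_k=1$ is vacuous. -}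

module Defs where

open import Data.Nat as ℕ using (ℕ; zero; suc; _<_; _≤_)
open import Data.Integer as ℤ using (ℤ; +_; -[1+_])
open import Data.Fin using (Fin; toℕ)
open import Data.Fin.Subset using (Subset; _∈_; _∉_; ∣_∣; inside; outside)
open import Data.Fin.Subset.Properties using (_∈?_)
open import Data.Fin.Properties using (all?)
open import Data.Bool using (Bool; true; false)
open import Data.Vec using (Vec; []; _∷_)
open import Data.List using (List; []; _∷_; _++_; map; length; filter)
open import Data.Product using (Σ; _×_; _,_; ∃)
open import Data.Sum using (_⊎_)
open import Function.Definitions using (Injective)
open import Relation.Binary.PropositionalEquality using (_≡_; _≢_)
open import Relation.Nullary using (Dec; ¬_)
open import Relation.Nullary.Decidable using (_×-dec_; _→-dec_; ¬?)
open import Data.Fin using (_≟_)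

record Graph (n : ℕ) : Set where
  field
    adj   : Fin n → Fin n → Bool
    sym   : ∀ u v → adj u v ≡ adj v u
    irrefl : ∀ v → adj v v ≡ false
open Graph public

Adj : ∀ {n} → Graph n → Fin n → Fin n → Set
Adj G u v = adj G u v ≡ true

IsClique : ∀ {n} → Graph n → Subset n → Set
IsClique {n} G S = ∀ (u v : Fin n) → u ∈ S → v ∈ S → u ≢ v → Adj G u v

isClique? : ∀ {n} (G : Graph n) (S : Subset n) → Dec (IsClique G S)
isClique? G S = all? λ u → all? λ v →
  (u ∈? S) →-dec ((v ∈? S) →-dec ((¬? (u ≟ v)) →-dec (adj G u v Data.Bool.≟ true)))

allSubsets : (n : ℕ) → List (Subset n)
allSubsets zero = [] ∷ []
allSubsets (suc n) = map (inside ∷_) (allSubsets n) ++ map (outside ∷_) (allSubsets n)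

numCliques : ∀ {n} → Graph n → ℕ → ℕ
numCliques {n} G i =
  length (filter (λ S → isClique? G S ×-dec (∣ S ∣ ℕ.≟ i)) (allSubsets n))

-- c is the clique vector of G, of length d = the largest size of a clique:
-- c_j (j = 1..d, stored at position j-1) = number of cliques with j vertices.
IsCliqueVector : ∀ {n} → Graph n → (d : ℕ) → Vec ℕ d → Set
IsCliqueVector {n} G d c =
  (Σ (Subset n) λ S → IsClique G S × ∣ S ∣ ≡ d)
  × (∀ S → IsClique G S → ∣ S ∣ ≤ d)
  × (∀ (j : Fin d) → Data.Vec.lookup c j ≡ numCliques G (suc (toℕ j)))

CycNext : (m : ℕ) → Fin m → Fin m → Set
CycNext m i j = toℕ j ≡ suc (toℕ i) ⊎ (suc (toℕ i) ≡ m × toℕ j ≡ 0)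

IsCycle : ∀ {n} → Graph n → (m : ℕ) → (Fin m → Fin n) → Set
IsCycle G m v = Injective _≡_ _≡_ v × (∀ i j → CycNext m i j → Adj G (v i) (v j))

HasChord : ∀ {n} → Graph n → (m : ℕ) → (Fin m → Fin n) → Set
HasChord G m v = Σ (Fin m) λ i → Σ (Fin m) λ j →
  i ≢ j × ¬ CycNext m i j × ¬ CycNext m j i × Adj G (v i) (v j)

Chordal : ∀ {n} → Graph n → Set
Chordal G = ∀ m → 4 ≤ m → ∀ v → IsCycle G m v → HasChord G m v

data Reach {n} (G : Graph n) (X : Subset n) : Fin n → Fin n → Set where
  here : ∀ {u} → u ∉ X → Reach G X u u
  step : ∀ {u w v} → u ∉ X → Adj G u w → Reach G X w v → Reach G X u v

ConnectedWithout : ∀ {n} → Graph n → Subset n → Set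
ConnectedWithout G X = ∀ u v → u ∉ X → v ∉ X → Reach G X u v

KConnected : ℕ → ∀ {n} → Graph n → Set
KConnected k {n} G = k ≤ n × (∀ (X : Subset n) → ∣ X ∣ < k → ConnectedWithout G X)

-- Integer polynomials as coefficient lists (constant term first)

Poly : Set
Poly = List ℤ

_⊕_ : Poly → Poly → Poly
[] ⊕ q = q
(a ∷ p) ⊕ [] = a ∷ p
(a ∷ p) ⊕ (b ∷ q) = (a ℤ.+ b) ∷ (p ⊕ q)

scale : ℤ → Poly → Poly
scale a = map (a ℤ.*_)

_⊗_ : Poly → Poly → Poly
[] ⊗ q = []
(a ∷ p) ⊗ q = scale a q ⊕ (+ 0 ∷ (p ⊗ q))

coeff : Poly → ℕ → ℤ
coeff [] i = + 0
coeff (a ∷ p) zero = a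
coeff (a ∷ p) (suc i) = coeff p i

xMinus1 : Poly
xMinus1 = -[1+ 0 ] ∷ + 1 ∷ []

sumPow : ∀ {d} → Vec ℕ d → Poly → Poly
sumPow [] p = []
sumPow (c ∷ cs) p = scale (+ c) p ⊕ sumPow cs (p ⊗ xMinus1)

-- Σ_{i=1}^d c_i (x-1)^{i-1}; b_i is its coefficient of x^{i-1}
bPoly : ∀ {d} → Vec ℕ d → Poly
bPoly c = sumPow c (+ 1 ∷ [])

-- Removing a simplicial vertex of degree m from a graph removes exactly (m C j) cliques with j + 1
-- vertices. By Dirac's lemma every chordal graph other than a clique Q has a simplicial vertex outside Q,
-- so a chordal graph with a maximum clique Q of size d can be dismantled down to Q one simplicial vertex
-- at a time. Hence c_(j+1) = Σ (m C j) over the multiset M of the eliminated degrees together with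
-- 0, 1, …, d - 1 (the clique Q itself), and since Σⱼ (m C j)(x - 1)ʲ = xᵐ, b_(i+1) is the multiplicity
-- of i in M. Each eliminated degree is < d, and is ≥ k when the graph is k-connected: otherwise the
-- neighbourhood of v would separate v from a vertex it is not adjacent to (there is one, or Q ∪ {v} would
-- be a larger clique). Conversely, for such b the split graph made of a d-clique and, for every
-- k ≤ i < d, b_(i+1) - 1 extra vertices each joined to i vertices of the clique is chordal, k-connected,
-- and has clique vector c, because the powers (x - 1)ʲ are linearly independent.

module Submission where

open import Data.Bool as Bool using (Bool; true; false; _∧_; _∨_; not; T; if_then_else_)
import Data.Bool.Properties as BoolP
open import Data.Empty using (⊥; ⊥-elim)
open import Data.Fin using (Fin; zero; suc; toℕ; fromℕ<)
import Data.Fin as Fin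
import Data.Fin.Properties as FinP
open import Data.Fin.Subset using (Subset; ∣_∣; inside; outside; _∈_; _∉_)
open import Data.Integer as Int using (ℤ; +_; -[1+_]; +<+) renaming (_<_ to _<ℤ_)
import Data.Integer.Properties as ℤP
import Data.Integer.Tactic.RingSolver as ℤ-Solver
open import Data.List using (List; []; _∷_; _++_; map; length; filter; downFrom; replicate)
open import Data.List.Membership.Propositional using () renaming (_∈_ to _∈ₗ_)
import Data.List.Membership.Propositional.Properties as ∈ₗP
open import Data.List.Relation.Unary.All using (All; []; _∷_)
import Data.List.Relation.Unary.All as All
import Data.List.Relation.Unary.All.Properties as AllP
import Data.List.Relation.Unary.Any as Any
open import Data.Nat as Nat using (ℕ; zero; suc; _<_; _≤_; z≤n; s≤s; _≡ᵇ_; _<ᵇ_)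
open import Data.Nat.Combinatorics using (_C_; nCn≡1; k>n⇒nCk≡0; nCk+nC[k+1]≡[n+1]C[k+1])
open import Data.Nat.Induction using (<-rec)
import Data.Nat.Properties as ℕP
import Data.Nat.Tactic.RingSolver as ℕ-Solver
open import Data.Product using (Σ; _×_; _,_; proj₁; proj₂)
open import Data.Sum using (_⊎_; inj₁; inj₂)
open import Data.Unit using (tt)
open import Data.Vec using (Vec; []; _∷_; lookup; _[_]≔_; tabulate)
import Data.Vec as Vec
import Data.Vec.Properties as VecP
open import Function using (_∘_; case_of_)
open import Function.Bundles using (_⇔_; mk⇔; Equivalence)
open import Relation.Binary.Definitions using (tri<; tri≈; tri>)
open import Relation.Binary.PropositionalEquality
open import Relation.Nullary using (Dec; does; yes; no; ¬_; contradiction)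
open import Relation.Nullary.Decidable using (dec-true; dec-false; _×-dec_; _⊎-dec_; _→-dec_; ¬?)
open import Relation.Unary using (Decidable)
open import Algebra.Properties.AbelianGroup ℤP.+-0-abelianGroup using (∙-cancelʳ)
open import Algebra.Properties.CommutativeSemigroup ℕP.+-commutativeSemigroup using ()
  renaming (interchange to +-interchange)

open import Defs hiding (sym; here; step)

δ : ℕ → ℕ → ℕ
δ zero    zero    = 1
δ zero    (suc i) = 0
δ (suc m) zero    = 0
δ (suc m) (suc i) = δ m i

δ-diag : ∀ i → δ i i ≡ 1
δ-diag zero    = refl
δ-diag (suc i) = δ-diag i

δ-≢ : ∀ {m i} → m ≢ i → δ m i ≡ 0
δ-≢ {zero}  {zero}  m≢i = contradiction refl m≢i
δ-≢ {zero}  {suc i} m≢i = refl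
δ-≢ {suc m} {zero}  m≢i = refl
δ-≢ {suc m} {suc i} m≢i = δ-≢ (m≢i ∘ cong suc)

occurrences : ℕ → List ℕ → ℕ
occurrences i []       = 0
occurrences i (m ∷ ms) = δ m i Nat.+ occurrences i ms

binomialSum : List ℕ → ℕ → ℕ
binomialSum []       j = 0
binomialSum (m ∷ ms) j = m C j Nat.+ binomialSum ms j

-- entry c j is c_(j+1) in the notation of the paper (and 0 beyond d)
entry : ∀ {d} → Vec ℕ d → ℕ → ℕ
entry []       j       = 0
entry (x ∷ c)  zero    = x
entry (x ∷ c)  (suc j) = entry c j

-- integer arithmetic is opened only in this block; everywhere else _+_ is addition on ℕ
module _ where
  open Int using (_+_; _*_; -_; _-_)
  open ℤ-Solver using (solve-∀)

  coeff-⊕ : ∀ p q i → coeff (p ⊕ q) i ≡ coeff p i + coeff q i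
  coeff-⊕ []      q       i       = sym (ℤP.+-identityˡ _)
  coeff-⊕ (a ∷ p) []      i       = sym (ℤP.+-identityʳ _)
  coeff-⊕ (a ∷ p) (b ∷ q) zero    = refl
  coeff-⊕ (a ∷ p) (b ∷ q) (suc i) = coeff-⊕ p q i

  coeff-scale : ∀ a p i → coeff (scale a p) i ≡ a * coeff p i
  coeff-scale a []      i       = sym (ℤP.*-zeroʳ a)
  coeff-scale a (x ∷ p) zero    = refl
  coeff-scale a (x ∷ p) (suc i) = coeff-scale a p i

  timesXMinus1 : (ℕ → ℤ) → ℕ → ℤ
  timesXMinus1 f zero    = - f zero
  timesXMinus1 f (suc i) = f i - f (suc i)

  timesXMinus1-cong : ∀ {f g} → (∀ i → f i ≡ g i) → ∀ i → timesXMinus1 f i ≡ timesXMinus1 g i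
  timesXMinus1-cong f≗g zero    = cong -_ (f≗g 0)
  timesXMinus1-cong f≗g (suc i) = cong₂ _-_ (f≗g i) (f≗g (suc i))

  coeff-⊗xMinus1 : ∀ p i → coeff (p ⊗ xMinus1) i ≡ timesXMinus1 (coeff p) i
  coeff-⊗xMinus1 []      zero    = refl
  coeff-⊗xMinus1 []      (suc i) = refl
  coeff-⊗xMinus1 (a ∷ p) i       = trans (coeff-⊕ (scale a xMinus1) (+ 0 ∷ p ⊗ xMinus1) i) (summands i)
    where
    summands : ∀ i → coeff (scale a xMinus1) i + coeff (+ 0 ∷ p ⊗ xMinus1) i ≡ timesXMinus1 (coeff (a ∷ p)) i
    summands zero          = trans (ℤP.+-identityʳ _) (trans (ℤP.*-comm a -[1+ 0 ]) (ℤP.-1*i≡-i a))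
    summands (suc zero)    = cong₂ _+_ (ℤP.*-identityʳ a) (coeff-⊗xMinus1 p 0)
    summands (suc (suc i)) = trans (ℤP.+-identityˡ _) (coeff-⊗xMinus1 p (suc i))

  timesXMinus1^ : ℕ → (ℕ → ℤ) → ℕ → ℤ
  timesXMinus1^ zero    f = f
  timesXMinus1^ (suc j) f = timesXMinus1^ j (timesXMinus1 f)

  timesXMinus1^-cong : ∀ j {f g} → (∀ i → f i ≡ g i) → ∀ i → timesXMinus1^ j f i ≡ timesXMinus1^ j g i
  timesXMinus1^-cong zero    f≗g = f≗g
  timesXMinus1^-cong (suc j) f≗g = timesXMinus1^-cong j (timesXMinus1-cong f≗g)

  timesXMinus1^-suc : ∀ j f i → timesXMinus1^ (suc j) f i ≡ timesXMinus1 (timesXMinus1^ j f) i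
  timesXMinus1^-suc zero    f i = refl
  timesXMinus1^-suc (suc j) f i = timesXMinus1^-suc j (timesXMinus1 f) i

  sumTo : ℕ → (ℕ → ℤ) → ℤ
  sumTo zero    f = + 0
  sumTo (suc d) f = sumTo d f + f d

  sumTo-cong : ∀ d {f g} → (∀ j → j < d → f j ≡ g j) → sumTo d f ≡ sumTo d g
  sumTo-cong zero    f≗g = refl
  sumTo-cong (suc d) f≗g = cong₂ _+_ (sumTo-cong d (λ j j<d → f≗g j (ℕP.m<n⇒m<1+n j<d))) (f≗g d ℕP.≤-refl)

  sumTo-zero : ∀ d f → (∀ j → j < d → f j ≡ + 0) → sumTo d f ≡ + 0
  sumTo-zero zero    f f≗0 = refl
  sumTo-zero (suc d) f f≗0 = cong₂ _+_ (sumTo-zero d f (λ j j<d → f≗0 j (ℕP.m<n⇒m<1+n j<d))) (f≗0 d ℕP.≤-refl)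

  sumTo-suc : ∀ d f → sumTo (suc d) f ≡ f 0 + sumTo d (f ∘ suc)
  sumTo-suc zero    f = ℤP.+-comm (+ 0) (f 0)
  sumTo-suc (suc d) f = trans (cong (_+ f (suc d)) (sumTo-suc d f)) (ℤP.+-assoc (f 0) _ _)

  sumTo-+ : ∀ d f g → sumTo d (λ j → f j + g j) ≡ sumTo d f + sumTo d g
  sumTo-+ zero    f g = refl
  sumTo-+ (suc d) f g = trans (cong (_+ (f d + g d)) (sumTo-+ d f g)) (interchange (sumTo d f) (sumTo d g) (f d) (g d))
    where interchange : ∀ a b c e → (a + b) + (c + e) ≡ (a + c) + (b + e)
          interchange = solve-∀

  timesXMinus1-sumTo : ∀ d (a : ℕ → ℤ) (F : ℕ → ℕ → ℤ) i →
    timesXMinus1 (λ i → sumTo d (λ j → a j * F j i)) i ≡ sumTo d (λ j → a j * timesXMinus1 (F j) i)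
  timesXMinus1-sumTo zero    a F zero    = refl
  timesXMinus1-sumTo zero    a F (suc i) = refl
  timesXMinus1-sumTo (suc d) a F zero    =
    trans (ℤP.neg-distrib-+ (sumTo d (λ j → a j * F j 0)) _)
          (cong₂ _+_ (timesXMinus1-sumTo d a F zero) (ℤP.neg-distribʳ-* (a d) (F d 0)))
  timesXMinus1-sumTo (suc d) a F (suc i) =
    trans (regroup (sumTo d (λ j → a j * F j i)) (sumTo d (λ j → a j * F j (suc i))) (a d) (F d i) (F d (suc i)))
          (cong (_+ (a d * (F d i - F d (suc i)))) (timesXMinus1-sumTo d a F (suc i)))
    where regroup : ∀ s t a x y → (s + a * x) - (t + a * y) ≡ (s - t) + a * (x - y)
          regroup = solve-∀

  -- powXMinus1 j i is the coefficient of xⁱ in (x - 1)ʲ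
  powXMinus1 : ℕ → ℕ → ℤ
  powXMinus1 j = timesXMinus1^ j (λ i → + δ 0 i)

  powXMinus1-suc : ∀ j i → powXMinus1 (suc j) i ≡ timesXMinus1 (powXMinus1 j) i
  powXMinus1-suc j = timesXMinus1^-suc j (λ i → + δ 0 i)

  powXMinus1-above : ∀ j i → j < i → powXMinus1 j i ≡ + 0
  powXMinus1-above zero    (suc i) _         = refl
  powXMinus1-above (suc j) (suc i) (s≤s j<i) = trans (powXMinus1-suc j (suc i))
    (cong₂ _-_ (powXMinus1-above j i j<i) (powXMinus1-above j (suc i) (ℕP.m<n⇒m<1+n j<i)))

  powXMinus1-diag : ∀ j → powXMinus1 j j ≡ + 1
  powXMinus1-diag zero    = refl
  powXMinus1-diag (suc j) = trans (powXMinus1-suc j (suc j))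
    (cong₂ _-_ (powXMinus1-diag j) (powXMinus1-above j (suc j) ℕP.≤-refl))

  coeff-sumPow : ∀ {d} (c : Vec ℕ d) p i →
    coeff (sumPow c p) i ≡ sumTo d (λ j → + entry c j * timesXMinus1^ j (coeff p) i)
  coeff-sumPow []              p i = refl
  coeff-sumPow {suc d} (x ∷ c) p i = begin
    coeff (scale (+ x) p ⊕ sumPow c (p ⊗ xMinus1)) i
      ≡⟨ coeff-⊕ (scale (+ x) p) _ i ⟩
    coeff (scale (+ x) p) i + coeff (sumPow c (p ⊗ xMinus1)) i
      ≡⟨ cong₂ _+_ (coeff-scale (+ x) p i) (coeff-sumPow c (p ⊗ xMinus1) i) ⟩
    + x * coeff p i + sumTo d (λ j → + entry c j * timesXMinus1^ j (coeff (p ⊗ xMinus1)) i)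
      ≡⟨ cong (λ s → + x * coeff p i + s) (sumTo-cong d (λ j _ →
           cong (+ entry c j *_) (timesXMinus1^-cong j (coeff-⊗xMinus1 p) i))) ⟩
    + x * coeff p i + sumTo d (λ j → + entry c j * timesXMinus1^ (suc j) (coeff p) i)
      ≡⟨ sumTo-suc d (λ j → + entry (x ∷ c) j * timesXMinus1^ j (coeff p) i) ⟨
    sumTo (suc d) (λ j → + entry (x ∷ c) j * timesXMinus1^ j (coeff p) i) ∎
    where open ≡-Reasoning

  coeff-bPoly : ∀ {d} (c : Vec ℕ d) i → coeff (bPoly c) i ≡ sumTo d (λ j → + entry c j * powXMinus1 j i)
  coeff-bPoly {d} c i = trans (coeff-sumPow c (+ 1 ∷ []) i)
    (sumTo-cong d (λ j _ → cong (+ entry c j *_) (timesXMinus1^-cong j coeff-one i)))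
    where coeff-one : ∀ i → coeff (+ 1 ∷ []) i ≡ + δ 0 i
          coeff-one zero    = refl
          coeff-one (suc i) = refl

  δ-timesXMinus1 : ∀ m i → + δ m i + timesXMinus1 (λ i → + δ m i) i ≡ + δ (suc m) i
  δ-timesXMinus1 m zero    = ℤP.+-inverseʳ (+ δ m 0)
  δ-timesXMinus1 m (suc i) = telescope (+ δ m (suc i)) (+ δ m i)
    where telescope : ∀ a b → a + (b - a) ≡ b
          telescope = solve-∀

  binomial-powXMinus1 : ∀ m D → m < D → ∀ i → sumTo D (λ j → + (m C j) * powXMinus1 j i) ≡ + δ m i
  binomial-powXMinus1 zero (suc D) _ i =
    trans (sumTo-suc D (λ j → + (0 C j) * powXMinus1 j i))
          (trans (cong₂ _+_ (ℤP.*-identityˡ (powXMinus1 0 i))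
                            (sumTo-zero D _ (λ j _ → ℤP.*-zeroˡ (powXMinus1 (suc j) i))))
                 (ℤP.+-identityʳ (+ δ 0 i)))
  binomial-powXMinus1 (suc m) (suc D) (s≤s m<D) i = begin
    sumTo (suc D) (λ j → + (suc m C j) * e j i)
      ≡⟨ sumTo-suc D _ ⟩
    + 1 * e 0 i + sumTo D (λ j → + (suc m C suc j) * e (suc j) i)
      ≡⟨ cong (λ s → + 1 * e 0 i + s) (trans (sumTo-cong D (λ j _ → pascal j)) (sumTo-+ D _ _)) ⟩
    + 1 * e 0 i + (sumTo D (λ j → + (m C suc j) * e (suc j) i) + sumTo D (λ j → + (m C j) * e (suc j) i))
      ≡⟨ ℤP.+-assoc (+ 1 * e 0 i) (sumTo D (λ j → + (m C suc j) * e (suc j) i)) _ ⟨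
    (+ 1 * e 0 i + sumTo D (λ j → + (m C suc j) * e (suc j) i)) + sumTo D (λ j → + (m C j) * e (suc j) i)
      ≡⟨ cong₂ _+_ (sym (sumTo-suc D (λ j → + (m C j) * e j i)))
                   (sumTo-cong D (λ j _ → cong (+ (m C j) *_) (powXMinus1-suc j i))) ⟩
    sumTo (suc D) (λ j → + (m C j) * e j i) + sumTo D (λ j → + (m C j) * timesXMinus1 (e j) i)
      ≡⟨ cong₂ _+_ (binomial-powXMinus1 m (suc D) (ℕP.m<n⇒m<1+n m<D) i)
                   (sym (timesXMinus1-sumTo D (λ j → + (m C j)) e i)) ⟩
    + δ m i + timesXMinus1 (λ i → sumTo D (λ j → + (m C j) * e j i)) i
      ≡⟨ cong (λ s → + δ m i + s) (timesXMinus1-cong (binomial-powXMinus1 m D m<D) i) ⟩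
    + δ m i + timesXMinus1 (λ i → + δ m i) i
      ≡⟨ δ-timesXMinus1 m i ⟩
    + δ (suc m) i ∎
    where
    open ≡-Reasoning
    e : ℕ → ℕ → ℤ
    e = powXMinus1
    pascal : ∀ j → + (suc m C suc j) * e (suc j) i ≡ + (m C suc j) * e (suc j) i + + (m C j) * e (suc j) i
    pascal j = trans (cong (λ n → + n * e (suc j) i)
                       (trans (sym (nCk+nC[k+1]≡[n+1]C[k+1] m j)) (ℕP.+-comm (m C j) (m C suc j))))
                 (trans (cong (_* e (suc j) i) (ℤP.pos-+ (m C suc j) (m C j)))
                        (ℤP.*-distribʳ-+ (e (suc j) i) (+ (m C suc j)) (+ (m C j))))

  binomialSum-powXMinus1 : ∀ d ms → All (_< d) ms → ∀ i →
    sumTo d (λ j → + binomialSum ms j * powXMinus1 j i) ≡ + occurrences i ms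
  binomialSum-powXMinus1 d []       []         i = sumTo-zero d _ (λ j _ → ℤP.*-zeroˡ (powXMinus1 j i))
  binomialSum-powXMinus1 d (m ∷ ms) (m<d ∷ ms<d) i = begin
    sumTo d (λ j → + (m C j Nat.+ binomialSum ms j) * powXMinus1 j i)
      ≡⟨ sumTo-cong d (λ j _ → trans (cong (_* powXMinus1 j i) (ℤP.pos-+ (m C j) (binomialSum ms j)))
                                     (ℤP.*-distribʳ-+ (powXMinus1 j i) (+ (m C j)) (+ binomialSum ms j))) ⟩
    sumTo d (λ j → + (m C j) * powXMinus1 j i + + binomialSum ms j * powXMinus1 j i)
      ≡⟨ sumTo-+ d _ _ ⟩
    sumTo d (λ j → + (m C j) * powXMinus1 j i) + sumTo d (λ j → + binomialSum ms j * powXMinus1 j i)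
      ≡⟨ cong₂ _+_ (binomial-powXMinus1 m d m<d i) (binomialSum-powXMinus1 d ms ms<d i) ⟩
    + δ m i + + occurrences i ms
      ≡⟨ ℤP.pos-+ (δ m i) (occurrences i ms) ⟨
    + occurrences i (m ∷ ms) ∎
    where open ≡-Reasoning

  -- the powers (x - 1)ʲ are triangular with unit diagonal, hence independent
  powXMinus1-independent : ∀ d (a a' : ℕ → ℕ) →
    (∀ i → i < d → sumTo d (λ j → + a j * powXMinus1 j i) ≡ sumTo d (λ j → + a' j * powXMinus1 j i)) →
    ∀ j → j < d → a j ≡ a' j
  powXMinus1-independent (suc d) a a' same = agree
    where
    top : ∀ (a : ℕ → ℕ) → sumTo (suc d) (λ j → + a j * powXMinus1 j d) ≡ + a d
    top a = trans (cong₂ _+_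
                    (sumTo-zero d _ (λ j j<d → trans (cong (+ a j *_) (powXMinus1-above j d j<d)) (ℤP.*-zeroʳ (+ a j))))
                    (trans (cong (+ a d *_) (powXMinus1-diag d)) (ℤP.*-identityʳ (+ a d))))
                  (ℤP.+-identityˡ _)
    agree-top : a d ≡ a' d
    agree-top = ℤP.+-injective (trans (sym (top a)) (trans (same d ℕP.≤-refl) (top a')))
    same-below : ∀ i → i < d → sumTo d (λ j → + a j * powXMinus1 j i) ≡ sumTo d (λ j → + a' j * powXMinus1 j i)
    same-below i i<d = ∙-cancelʳ _ _ _ (trans (same i (ℕP.m<n⇒m<1+n i<d))
      (cong (λ z → sumTo d (λ j → + a' j * powXMinus1 j i) + + z * powXMinus1 d i) (sym agree-top)))
    agree : ∀ j → j < suc d → a j ≡ a' j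
    agree j j<1+d with ℕP.m≤n⇒m<n∨m≡n (ℕP.≤-pred j<1+d)
    ... | inj₁ j<d  = powXMinus1-independent d a a' same-below j j<d
    ... | inj₂ refl = agree-top

  coeff-bPoly-above : ∀ {d} (c : Vec ℕ d) i → d ≤ i → coeff (bPoly c) i ≡ + 0
  coeff-bPoly-above {d} c i d≤i = trans (coeff-bPoly c i) (sumTo-zero d _ (λ j j<d →
    trans (cong (+ entry c j *_) (powXMinus1-above j i (ℕP.<-≤-trans j<d d≤i))) (ℤP.*-zeroʳ (+ entry c j))))

  entry≡binomialSum⇔coeff≡occurrences : ∀ {d} (c : Vec ℕ d) ms → All (_< d) ms →
    (∀ j → j < d → entry c j ≡ binomialSum ms j) ⇔ (∀ i → i < d → coeff (bPoly c) i ≡ + occurrences i ms)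
  entry≡binomialSum⇔coeff≡occurrences {d} c ms ms<d = mk⇔
    (λ c≡ i _ → trans (coeff-bPoly c i)
      (trans (sumTo-cong d (λ j j<d → cong (λ z → + z * powXMinus1 j i) (c≡ j j<d)))
             (binomialSum-powXMinus1 d ms ms<d i)))
    (λ b≡ → powXMinus1-independent d (entry c) (binomialSum ms) (λ i i<d →
      trans (sym (coeff-bPoly c i)) (trans (b≡ i i<d) (sym (binomialSum-powXMinus1 d ms ms<d i)))))

open Nat using (_+_; _∸_)

∧-intro : ∀ {a b} → a ≡ true → b ≡ true → a ∧ b ≡ true
∧-intro refl refl = refl

∧-elimˡ : ∀ a {b} → a ∧ b ≡ true → a ≡ true
∧-elimˡ true _ = refl

∧-elimʳ : ∀ a {b} → a ∧ b ≡ true → b ≡ true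
∧-elimʳ true p = p

∨-introˡ : ∀ {a} b → a ≡ true → a ∨ b ≡ true
∨-introˡ b refl = refl

∨-introʳ : ∀ a {b} → b ≡ true → a ∨ b ≡ true
∨-introʳ true  _ = refl
∨-introʳ false p = p

∨-elim : ∀ a {b} → a ∨ b ≡ true → a ≡ true ⊎ b ≡ true
∨-elim true  _ = inj₁ refl
∨-elim false p = inj₂ p

not-true : ∀ {a} → not a ≡ true → a ≡ false
not-true {false} _ = refl

not-false : ∀ {a} → a ≡ false → not a ≡ true
not-false refl = refl

true≢false : ∀ {a} → a ≡ true → a ≡ false → ⊥
true≢false refl ()

true-or-false : ∀ (b : Bool) → b ≡ true ⊎ b ≡ false
true-or-false true  = inj₁ refl
true-or-false false = inj₂ refl

≡-from-⇔ : ∀ {a b} → (a ≡ true → b ≡ true) → (b ≡ true → a ≡ true) → a ≡ b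
≡-from-⇔ {true}  {true}  _ _ = refl
≡-from-⇔ {true}  {false} f _ = sym (f refl)
≡-from-⇔ {false} {true}  _ g = g refl
≡-from-⇔ {false} {false} _ _ = refl

does-true⇒ : ∀ {P : Set} (P? : Dec P) → does P? ≡ true → P
does-true⇒ (yes p) _ = p

bit : Bool → ℕ
bit true  = 1
bit false = 0

count : ∀ {A : Set} → (A → Bool) → List A → ℕ
count f []       = 0
count f (x ∷ xs) = bit (f x) + count f xs

length-filter : ∀ {A : Set} {P : A → Set} (P? : Decidable P) xs → length (filter P? xs) ≡ count (does ∘ P?) xs
length-filter P? []       = refl
length-filter P? (x ∷ xs) with does (P? x)
... | true  = cong suc (length-filter P? xs)
... | false = length-filter P? xs

count-cong : ∀ {A : Set} {f g : A → Bool} xs → (∀ x → f x ≡ g x) → count f xs ≡ count g xs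
count-cong []       f≗g = refl
count-cong (x ∷ xs) f≗g = cong₂ _+_ (cong bit (f≗g x)) (count-cong xs f≗g)

count-++ : ∀ {A : Set} (f : A → Bool) xs ys → count f (xs ++ ys) ≡ count f xs + count f ys
count-++ f []       ys = refl
count-++ f (x ∷ xs) ys = trans (cong (λ s → bit (f x) + s) (count-++ f xs ys)) (sym (ℕP.+-assoc (bit (f x)) _ _))

count-map : ∀ {A B : Set} (f : B → Bool) (h : A → B) xs → count f (map h xs) ≡ count (f ∘ h) xs
count-map f h []       = refl
count-map f h (x ∷ xs) = cong (λ s → bit (f (h x)) + s) (count-map f h xs)

count-false : ∀ {A : Set} (xs : List A) → count (λ _ → false) xs ≡ 0
count-false []       = refl
count-false (x ∷ xs) = count-false xs

count-split : ∀ {A : Set} (f r : A → Bool) xs →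
  count f xs ≡ count (λ x → f x ∧ r x) xs + count (λ x → f x ∧ not (r x)) xs
count-split f r []       = refl
count-split f r (x ∷ xs) =
  trans (cong₂ _+_ (bit-split (f x) (r x)) (count-split f r xs))
        (+-interchange (bit (f x ∧ r x)) (bit (f x ∧ not (r x))) (count (λ x → f x ∧ r x) xs) _)
  where bit-split : ∀ a r → bit a ≡ bit (a ∧ r) + bit (a ∧ not r)
        bit-split false r     = refl
        bit-split true  false = refl
        bit-split true  true  = refl

count-pos⇒∃ : ∀ {A : Set} (f : A → Bool) xs → 0 < count f xs → Σ A (λ x → x ∈ₗ xs × f x ≡ true)
count-pos⇒∃ f (x ∷ xs) p with f x in fx
... | true  = x , Any.here refl , fx
... | false = let (y , y∈xs , fy) = count-pos⇒∃ f xs p in y , Any.there y∈xs , fy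

∈⇒count-pos : ∀ {A : Set} (f : A → Bool) {x} xs → x ∈ₗ xs → f x ≡ true → 0 < count f xs
∈⇒count-pos f (y ∷ xs) (Any.here refl) fx rewrite fx = s≤s z≤n
∈⇒count-pos f (y ∷ xs) (Any.there x∈xs) fx = ℕP.≤-trans (∈⇒count-pos f xs x∈xs fx) (ℕP.m≤n+m _ (bit (f y)))

allSubsets-complete : ∀ {n} (S : Subset n) → S ∈ₗ allSubsets n
allSubsets-complete []                = Any.here refl
allSubsets-complete {suc n} (true ∷ S)  =
  ∈ₗP.∈-++⁺ˡ (∈ₗP.∈-map⁺ (inside ∷_) (allSubsets-complete S))
allSubsets-complete {suc n} (false ∷ S) =
  ∈ₗP.∈-++⁺ʳ (map (inside ∷_) (allSubsets n)) (∈ₗP.∈-map⁺ (outside ∷_) (allSubsets-complete S))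

countSubsets : ∀ n → (Subset n → Bool) → ℕ
countSubsets n f = count f (allSubsets n)

countSubsets-suc : ∀ n f →
  countSubsets (suc n) f ≡ countSubsets n (λ S → f (inside ∷ S)) + countSubsets n (λ S → f (outside ∷ S))
countSubsets-suc n f = trans (count-++ f (map (inside ∷_) (allSubsets n)) _)
  (cong₂ _+_ (count-map f (inside ∷_) (allSubsets n)) (count-map f (outside ∷_) (allSubsets n)))

countSubsets-cong : ∀ n {f g : Subset n → Bool} → (∀ S → f S ≡ g S) → countSubsets n f ≡ countSubsets n g
countSubsets-cong n = count-cong (allSubsets n)

countSubsets-false : ∀ n → countSubsets n (λ _ → false) ≡ 0
countSubsets-false n = count-false (allSubsets n)

-- S ↦ S ∖ {v} is a bijection from the subsets containing v onto those avoiding it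
countSubsets-∋ : ∀ n (v : Fin n) (g : Subset n → Bool) →
  countSubsets n (λ S → lookup S v ∧ g S) ≡ countSubsets n (λ S → not (lookup S v) ∧ g (S [ v ]≔ true))
countSubsets-∋ (suc n) zero g = begin
  countSubsets (suc n) (λ S → lookup S zero ∧ g S)
    ≡⟨ countSubsets-suc n _ ⟩
  countSubsets n (λ S → g (inside ∷ S)) + countSubsets n (λ _ → false)
    ≡⟨ cong (λ s → countSubsets n (λ S → g (inside ∷ S)) + s) (countSubsets-false n) ⟩
  countSubsets n (λ S → g (inside ∷ S)) + 0
    ≡⟨ ℕP.+-comm _ 0 ⟩
  0 + countSubsets n (λ S → g (inside ∷ S))
    ≡⟨ cong (_+ countSubsets n (λ S → g (inside ∷ S))) (countSubsets-false n) ⟨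
  countSubsets n (λ _ → false) + countSubsets n (λ S → g (inside ∷ S))
    ≡⟨ countSubsets-suc n _ ⟨
  countSubsets (suc n) (λ S → not (lookup S zero) ∧ g (S [ zero ]≔ true)) ∎
  where open ≡-Reasoning
countSubsets-∋ (suc n) (suc v) g = trans (countSubsets-suc n _)
  (trans (cong₂ _+_ (countSubsets-∋ n v (λ S → g (inside ∷ S))) (countSubsets-∋ n v (λ S → g (outside ∷ S))))
         (sym (countSubsets-suc n _)))

VSet : ℕ → Set
VSet n = Fin n → Bool

card : ∀ {n} → VSet n → ℕ
card {zero}  W = 0
card {suc n} W = bit (W zero) + card (W ∘ suc)

_⊆ᵇ_ : ∀ {n} → Subset n → VSet n → Bool
[]      ⊆ᵇ W = true
(s ∷ S) ⊆ᵇ W = (not s ∨ W zero) ∧ (S ⊆ᵇ (W ∘ suc))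

countSubsets-⊆-size : ∀ n (W : VSet n) j → countSubsets n (λ S → (S ⊆ᵇ W) ∧ (∣ S ∣ ≡ᵇ j)) ≡ card W C j
countSubsets-⊆-size zero    W zero    = refl
countSubsets-⊆-size zero    W (suc j) = refl
countSubsets-⊆-size (suc n) W j       = trans (countSubsets-suc n _) (split (W zero) refl j)
  where
  W′ : VSet n
  W′ = W ∘ suc
  split : ∀ b → W zero ≡ b → ∀ j →
    countSubsets n (λ S → ((false ∨ W zero) ∧ (S ⊆ᵇ W′)) ∧ (suc ∣ S ∣ ≡ᵇ j)) +
    countSubsets n (λ S → ((true ∨ W zero) ∧ (S ⊆ᵇ W′)) ∧ (∣ S ∣ ≡ᵇ j)) ≡ (bit (W zero) + card W′) C j
  split true  w0 zero rewrite w0 =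
    cong₂ _+_ (trans (countSubsets-cong n (λ S → BoolP.∧-zeroʳ (S ⊆ᵇ W′))) (countSubsets-false n))
              (countSubsets-⊆-size n W′ zero)
  split true  w0 (suc j) rewrite w0 =
    trans (cong₂ _+_ (countSubsets-⊆-size n W′ j) (countSubsets-⊆-size n W′ (suc j)))
          (nCk+nC[k+1]≡[n+1]C[k+1] (card W′) j)
  split false w0 j rewrite w0 =
    trans (cong (_+ countSubsets n (λ S → (S ⊆ᵇ W′) ∧ (∣ S ∣ ≡ᵇ j))) (countSubsets-false n))
          (countSubsets-⊆-size n W′ j)

<ᵇ-true : ∀ {m n} → m < n → (m <ᵇ n) ≡ true
<ᵇ-true {m} {n} m<n with m <ᵇ n | ℕP.<⇒<ᵇ m<n
... | true | _ = refl

<ᵇ-true⇒ : ∀ {m n} → (m <ᵇ n) ≡ true → m < n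
<ᵇ-true⇒ {m} {n} e = ℕP.<ᵇ⇒< m n (subst T (sym e) tt)

<ᵇ-false : ∀ {m n} → n ≤ m → (m <ᵇ n) ≡ false
<ᵇ-false {m} {n} n≤m with m <ᵇ n in e
... | false = refl
... | true  = contradiction (<ᵇ-true⇒ e) (ℕP.≤⇒≯ n≤m)

∈⇒lookup : ∀ {n} {x : Fin n} {S : Subset n} → x ∈ S → lookup S x ≡ true
∈⇒lookup = VecP.[]=⇒lookup

lookup⇒∈ : ∀ {n} {x : Fin n} {S : Subset n} → lookup S x ≡ true → x ∈ S
lookup⇒∈ {x = x} {S} = VecP.lookup⇒[]= x S

∉⇒lookup : ∀ {n} {x : Fin n} {S : Subset n} → x ∉ S → lookup S x ≡ false
∉⇒lookup {x = x} {S} x∉S with lookup S x in e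
... | false = refl
... | true  = contradiction (lookup⇒∈ e) x∉S

⊆ᵇ-elim : ∀ {n} (S : Subset n) W {x} → S ⊆ᵇ W ≡ true → x ∈ S → W x ≡ true
⊆ᵇ-elim (s ∷ S) W {zero}  S⊆W Vec.here        = ∧-elimˡ _ S⊆W
⊆ᵇ-elim (s ∷ S) W {suc x} S⊆W (Vec.there x∈S) = ⊆ᵇ-elim S (W ∘ suc) (∧-elimʳ (not s ∨ W zero) S⊆W) x∈S

⊆ᵇ-intro : ∀ {n} (S : Subset n) W → (∀ x → x ∈ S → W x ≡ true) → S ⊆ᵇ W ≡ true
⊆ᵇ-intro []          W S⊆W = refl
⊆ᵇ-intro (true ∷ S)  W S⊆W = ∧-intro (S⊆W zero Vec.here) (⊆ᵇ-intro S _ (λ x x∈S → S⊆W (suc x) (Vec.there x∈S)))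
⊆ᵇ-intro (false ∷ S) W S⊆W = ⊆ᵇ-intro S _ (λ x x∈S → S⊆W (suc x) (Vec.there x∈S))

⊆ᵇ-cong : ∀ {n} (S : Subset n) {V W} → (∀ x → V x ≡ W x) → S ⊆ᵇ V ≡ S ⊆ᵇ W
⊆ᵇ-cong S V≗W = ≡-from-⇔ (λ p → ⊆ᵇ-intro S _ (λ x x∈S → trans (sym (V≗W x)) (⊆ᵇ-elim S _ p x∈S)))
                         (λ p → ⊆ᵇ-intro S _ (λ x x∈S → trans (V≗W x) (⊆ᵇ-elim S _ p x∈S)))

_≟ᵇ_ : ∀ {n} → Fin n → Fin n → Bool
x ≟ᵇ v = does (x Fin.≟ v)

≟ᵇ-refl : ∀ {n} (x : Fin n) → x ≟ᵇ x ≡ true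
≟ᵇ-refl x = dec-true (x Fin.≟ x) refl

≟ᵇ-true⇒ : ∀ {n} {x v : Fin n} → x ≟ᵇ v ≡ true → x ≡ v
≟ᵇ-true⇒ {x = x} {v} = does-true⇒ (x Fin.≟ v)

≟ᵇ-≢ : ∀ {n} {x v : Fin n} → x ≢ v → x ≟ᵇ v ≡ false
≟ᵇ-≢ {x = x} {v} = dec-false (x Fin.≟ v)

insert : ∀ {n} → Fin n → VSet n → VSet n
insert v V x = V x ∨ x ≟ᵇ v

remove : ∀ {n} → Fin n → VSet n → VSet n
remove v W x = W x ∧ not (x ≟ᵇ v)

remove-self : ∀ {n} v (W : VSet n) → remove v W v ≡ false
remove-self v W = trans (cong (λ b → W v ∧ not b) (≟ᵇ-refl v)) (BoolP.∧-zeroʳ (W v))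

∣insert∣ : ∀ {n} (S : Subset n) v → lookup S v ≡ false → ∣ S [ v ]≔ true ∣ ≡ suc ∣ S ∣
∣insert∣ (false ∷ S) zero    _  = refl
∣insert∣ (true ∷ S)  (suc v) v∉S = cong suc (∣insert∣ S v v∉S)
∣insert∣ (false ∷ S) (suc v) v∉S = ∣insert∣ S v v∉S

lookup-insert : ∀ {n} (S : Subset n) v x → lookup (S [ v ]≔ true) x ≡ true → x ≡ v ⊎ lookup S x ≡ true
lookup-insert S v x x∈S′ with x Fin.≟ v
... | yes x≡v = inj₁ x≡v
... | no  x≢v = inj₂ (trans (sym (VecP.lookup∘update′ x≢v S true)) x∈S′)

anyᵇ : ∀ {n} → VSet n → Bool
anyᵇ {zero}  W = false
anyᵇ {suc n} W = W zero ∨ anyᵇ (W ∘ suc)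

anyᵇ-intro : ∀ {n} (W : VSet n) x → W x ≡ true → anyᵇ W ≡ true
anyᵇ-intro W zero    Wx rewrite Wx = refl
anyᵇ-intro W (suc x) Wx = ∨-introʳ (W zero) (anyᵇ-intro (W ∘ suc) x Wx)

anyᵇ-elim : ∀ {n} (W : VSet n) → anyᵇ W ≡ true → Σ (Fin n) λ x → W x ≡ true
anyᵇ-elim {suc n} W any with W zero in W0
... | true  = zero , W0
... | false = let (x , Wx) = anyᵇ-elim (W ∘ suc) any in suc x , Wx

anyᵇ-false : ∀ {n} (W : VSet n) → anyᵇ W ≡ false → ∀ x → W x ≡ false
anyᵇ-false W none x with W x in Wx
... | false = refl
... | true  = contradiction (anyᵇ-intro W x Wx) (λ any → true≢false any none)

card-mono : ∀ {n} (V W : VSet n) → (∀ x → V x ≡ true → W x ≡ true) → card V ≤ card W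
card-mono {zero}  V W V⊆W = z≤n
card-mono {suc n} V W V⊆W with V zero in V0 | W zero in W0
... | true  | true  = s≤s (card-mono _ _ (V⊆W ∘ suc))
... | false | true  = ℕP.m≤n⇒m≤1+n (card-mono _ _ (V⊆W ∘ suc))
... | false | false = card-mono _ _ (V⊆W ∘ suc)
... | true  | false = contradiction (V⊆W zero V0) (λ W0′ → true≢false W0′ W0)

card-strict : ∀ {n} (V W : VSet n) → (∀ x → V x ≡ true → W x ≡ true) →
  ∀ a → W a ≡ true → V a ≡ false → card V < card W
card-strict {suc n} V W V⊆W zero    Wa Va rewrite Wa | Va = s≤s (card-mono _ _ (V⊆W ∘ suc))
card-strict {suc n} V W V⊆W (suc a) Wa Va with V zero in V0 | W zero in W0
... | true  | true  = s≤s (card-strict _ _ (V⊆W ∘ suc) a Wa Va)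
... | false | true  = ℕP.m≤n⇒m≤1+n (card-strict _ _ (V⊆W ∘ suc) a Wa Va)
... | false | false = card-strict _ _ (V⊆W ∘ suc) a Wa Va
... | true  | false = contradiction (V⊆W zero V0) (λ W0′ → true≢false W0′ W0)

card-cong : ∀ {n} (V W : VSet n) → (∀ x → V x ≡ W x) → card V ≡ card W
card-cong V W V≗W = ℕP.≤-antisym (card-mono V W (λ x p → trans (sym (V≗W x)) p))
                                 (card-mono W V (λ x p → trans (V≗W x) p))

≟ᵇ-suc : ∀ {n} (x v : Fin n) → suc x ≟ᵇ suc v ≡ x ≟ᵇ v
≟ᵇ-suc x v with x Fin.≟ v
... | yes refl = refl
... | no  _    = refl

card-insert : ∀ {n} (V : VSet n) v → V v ≡ false → card (insert v V) ≡ suc (card V)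
card-insert {suc n} V zero    Vv rewrite Vv = cong suc (card-cong _ _ (λ x → BoolP.∨-identityʳ (V (suc x))))
card-insert {suc n} V (suc v) Vv = trans
  (cong₂ _+_ (cong bit (BoolP.∨-identityʳ (V zero)))
             (trans (card-cong _ _ (λ x → cong (V (suc x) ∨_) (≟ᵇ-suc x v))) (card-insert (V ∘ suc) v Vv)))
  (ℕP.+-suc (bit (V zero)) (card (V ∘ suc)))

card-lookup : ∀ {n} (S : Subset n) → card (lookup S) ≡ ∣ S ∣
card-lookup []          = refl
card-lookup (true ∷ S)  = cong suc (card-lookup S)
card-lookup (false ∷ S) = card-lookup S

∣tabulate∣ : ∀ {n} (W : VSet n) → ∣ tabulate W ∣ ≡ card W
∣tabulate∣ {zero}  W = refl
∣tabulate∣ {suc n} W with W zero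
... | true  = cong suc (∣tabulate∣ (W ∘ suc))
... | false = ∣tabulate∣ (W ∘ suc)

∈-tabulate⇒ : ∀ {n} {W : VSet n} {x} → x ∈ tabulate W → W x ≡ true
∈-tabulate⇒ {W = W} {x} x∈W = trans (sym (VecP.lookup∘tabulate W x)) (∈⇒lookup x∈W)

card≤n : ∀ {n} (W : VSet n) → card W ≤ n
card≤n {zero}  W = z≤n
card≤n {suc n} W with W zero
... | true  = s≤s (card≤n (W ∘ suc))
... | false = ℕP.m≤n⇒m≤1+n (card≤n (W ∘ suc))

card-all : ∀ n → card {n} (λ _ → true) ≡ n
card-all zero    = refl
card-all (suc n) = cong suc (card-all n)

card-initial : ∀ n m → m ≤ n → card {n} (λ x → toℕ x <ᵇ m) ≡ m
card-initial zero    zero    _         = refl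
card-initial (suc n) zero    _         = card-initial n zero z≤n
card-initial (suc n) (suc m) (s≤s m≤n) = cong suc (card-initial n m m≤n)

⊆ᵇ-remove : ∀ {n} (S : Subset n) v W → S ⊆ᵇ remove v W ≡ (S ⊆ᵇ W) ∧ not (lookup S v)
⊆ᵇ-remove S v W = ≡-from-⇔ to from
  where
  to : S ⊆ᵇ remove v W ≡ true → (S ⊆ᵇ W) ∧ not (lookup S v) ≡ true
  to S⊆W-v = ∧-intro (⊆ᵇ-intro S W (λ x x∈S → ∧-elimˡ (W x) (⊆ᵇ-elim S _ S⊆W-v x∈S)))
                     (not-false v∉S)
    where
    v∉S : lookup S v ≡ false
    v∉S with lookup S v in e
    ... | false = refl
    ... | true  = contradiction (≟ᵇ-refl v) λ v≡v →
                    true≢false v≡v (not-true (∧-elimʳ (W v) (⊆ᵇ-elim S _ S⊆W-v (lookup⇒∈ e))))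
  from : (S ⊆ᵇ W) ∧ not (lookup S v) ≡ true → S ⊆ᵇ remove v W ≡ true
  from p = ⊆ᵇ-intro S _ (λ x x∈S → ∧-intro (⊆ᵇ-elim S W (∧-elimˡ (S ⊆ᵇ W) p) x∈S)
             (not-false (≟ᵇ-≢ {x = x} {v} λ { refl → true≢false (∈⇒lookup x∈S) (not-true (∧-elimʳ (S ⊆ᵇ W) p)) })))

Adj-sym : ∀ {n} (G : Graph n) {u v} → Adj G u v → Adj G v u
Adj-sym G {u} {v} uv = trans (Graph.sym G v u) uv

Adj-irrefl : ∀ {n} (G : Graph n) {v} → Adj G v v → ⊥
Adj-irrefl G {v} vv = true≢false vv (irrefl G v)

module Cliques {n} (G : Graph n) where

  isCliqueᵇ : Subset n → Bool
  isCliqueᵇ S = does (isClique? G S)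

  cliquesIn : VSet n → ℕ → ℕ
  cliquesIn W j = countSubsets n (λ S → (isCliqueᵇ S ∧ (S ⊆ᵇ W)) ∧ (∣ S ∣ ≡ᵇ j))

  numCliques≡cliquesIn : ∀ j → numCliques G j ≡ cliquesIn (λ _ → true) j
  numCliques≡cliquesIn j = trans (length-filter (λ S → isClique? G S ×-dec (∣ S ∣ Nat.≟ j)) (allSubsets n))
    (countSubsets-cong n (λ S → cong (_∧ (∣ S ∣ ≡ᵇ j))
      (sym (trans (cong (isCliqueᵇ S ∧_) (⊆ᵇ-intro S _ (λ _ _ → refl))) (BoolP.∧-identityʳ (isCliqueᵇ S))))))

  cliquesIn-cong : ∀ V W → (∀ x → V x ≡ W x) → ∀ j → cliquesIn V j ≡ cliquesIn W j
  cliquesIn-cong V W V≗W j =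
    countSubsets-cong n (λ S → cong (λ b → (isCliqueᵇ S ∧ b) ∧ (∣ S ∣ ≡ᵇ j)) (⊆ᵇ-cong S V≗W))

  IsCliqueᵛ : VSet n → Set
  IsCliqueᵛ Q = ∀ x y → Q x ≡ true → Q y ≡ true → x ≢ y → Adj G x y

  private
    adjacent-if-in? : ∀ (Q : VSet n) x y → Dec (Q x ≡ true → Q y ≡ true → x ≢ y → Adj G x y)
    adjacent-if-in? Q x y =
      (Q x Bool.≟ true) →-dec ((Q y Bool.≟ true) →-dec (¬? (x Fin.≟ y) →-dec (adj G x y Bool.≟ true)))

  isCliqueᵛ? : ∀ Q → Dec (IsCliqueᵛ Q)
  isCliqueᵛ? Q = FinP.all? λ x → FinP.all? (adjacent-if-in? Q x)

  ¬IsCliqueᵛ⇒nonadjacent : ∀ W → ¬ IsCliqueᵛ W →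
    Σ (Fin n) λ a → Σ (Fin n) λ b → W a ≡ true × W b ≡ true × a ≢ b × adj G a b ≡ false
  ¬IsCliqueᵛ⇒nonadjacent W ¬clique with FinP.¬∀⟶∃¬ n _ (λ x → FinP.all? (adjacent-if-in? W x)) ¬clique
  ... | (a , ¬a) with FinP.¬∀⟶∃¬ n _ (adjacent-if-in? W a) ¬a
  ...   | (b , ¬ab) with true-or-false (W a) | true-or-false (W b) | a Fin.≟ b | true-or-false (adj G a b)
  ...     | inj₂ Wa  | _        | _       | _      = contradiction (λ Wa′ → contradiction Wa (true≢false Wa′)) ¬ab
  ...     | inj₁ _   | inj₂ Wb  | _       | _      = contradiction (λ _ Wb′ → contradiction Wb (true≢false Wb′)) ¬ab
  ...     | inj₁ _   | inj₁ _   | yes a≡b | _      = contradiction (λ _ _ a≢b → contradiction a≡b a≢b) ¬ab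
  ...     | inj₁ _   | inj₁ _   | no _    | inj₁ ab = contradiction (λ _ _ _ → ab) ¬ab
  ...     | inj₁ Wa  | inj₁ Wb  | no a≢b  | inj₂ a≁b = a , b , Wa , Wb , a≢b , a≁b

  neighboursIn : VSet n → Fin n → VSet n
  neighboursIn W v x = adj G v x ∧ W x

  Simplicial : VSet n → Fin n → Set
  Simplicial W v = ∀ x y → W x ≡ true → W y ≡ true → Adj G v x → Adj G v y → x ≢ y → Adj G x y

  private
    extends-to-clique : ∀ W v S → W v ≡ true → Simplicial W v → lookup S v ≡ false →
      isCliqueᵇ (S [ v ]≔ true) ∧ ((S [ v ]≔ true) ⊆ᵇ W) ≡ S ⊆ᵇ neighboursIn W v
    extends-to-clique W v S Wv simplicial v∉S = ≡-from-⇔ to from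
      where
      S′ : Subset n
      S′ = S [ v ]≔ true
      v∈S′ : v ∈ S′
      v∈S′ = lookup⇒∈ (VecP.lookup∘update v S true)
      S⊆S′ : ∀ {x} → x ∈ S → x ∈ S′
      S⊆S′ {x} x∈S = lookup⇒∈ (trans (VecP.lookup∘update′ (x≢v x∈S) S true) (∈⇒lookup x∈S))
        where x≢v : ∀ {x} → x ∈ S → x ≢ v
              x≢v x∈S refl = true≢false (∈⇒lookup x∈S) v∉S
      to : isCliqueᵇ S′ ∧ (S′ ⊆ᵇ W) ≡ true → S ⊆ᵇ neighboursIn W v ≡ true
      to p = ⊆ᵇ-intro S _ (λ x x∈S → ∧-intro
               (does-true⇒ (isClique? G S′) (∧-elimˡ (isCliqueᵇ S′) p) v x v∈S′ (S⊆S′ x∈S)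
                 (λ { refl → true≢false (∈⇒lookup x∈S) v∉S }))
               (⊆ᵇ-elim S′ W (∧-elimʳ (isCliqueᵇ S′) p) (S⊆S′ x∈S)))
      from : S ⊆ᵇ neighboursIn W v ≡ true → isCliqueᵇ S′ ∧ (S′ ⊆ᵇ W) ≡ true
      from S⊆N = ∧-intro (dec-true (isClique? G S′) clique) (⊆ᵇ-intro S′ W inW)
        where
        inN : ∀ {x} → lookup S x ≡ true → neighboursIn W v x ≡ true
        inN x∈S = ⊆ᵇ-elim S _ S⊆N (lookup⇒∈ x∈S)
        inW : ∀ x → x ∈ S′ → W x ≡ true
        inW x x∈S′ with lookup-insert S v x (∈⇒lookup x∈S′)
        ... | inj₁ refl = Wv
        ... | inj₂ x∈S  = ∧-elimʳ (adj G v x) (inN x∈S)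
        clique : IsClique G S′
        clique x y x∈S′ y∈S′ x≢y with lookup-insert S v x (∈⇒lookup x∈S′) | lookup-insert S v y (∈⇒lookup y∈S′)
        ... | inj₁ refl | inj₁ refl = contradiction refl x≢y
        ... | inj₁ refl | inj₂ y∈S  = ∧-elimˡ _ (inN y∈S)
        ... | inj₂ x∈S  | inj₁ refl = Adj-sym G (∧-elimˡ _ (inN x∈S))
        ... | inj₂ x∈S  | inj₂ y∈S  = simplicial x y (∧-elimʳ (adj G v x) (inN x∈S)) (∧-elimʳ (adj G v y) (inN y∈S))
                                        (∧-elimˡ _ (inN x∈S)) (∧-elimˡ _ (inN y∈S)) x≢y

    cliques-through : ∀ W v S j → W v ≡ true → Simplicial W v →
      not (lookup S v) ∧ ((isCliqueᵇ (S [ v ]≔ true) ∧ ((S [ v ]≔ true) ⊆ᵇ W)) ∧ (∣ S [ v ]≔ true ∣ ≡ᵇ suc j))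
        ≡ (S ⊆ᵇ neighboursIn W v) ∧ (∣ S ∣ ≡ᵇ j)
    cliques-through W v S j Wv simplicial with lookup S v in v∈S
    ... | true  = sym (cong (_∧ (∣ S ∣ ≡ᵇ j)) (≡-from-⇔ v∉N (λ ())))
      where v∉N : S ⊆ᵇ neighboursIn W v ≡ true → false ≡ true
            v∉N S⊆N = contradiction (∧-elimˡ (adj G v v) (⊆ᵇ-elim S _ S⊆N (lookup⇒∈ v∈S))) (Adj-irrefl G)
    ... | false rewrite ∣insert∣ S v v∈S = cong (_∧ (∣ S ∣ ≡ᵇ j)) (extends-to-clique W v S Wv simplicial v∈S)

    reassociate : ∀ a b c d → ((a ∧ b) ∧ c) ∧ d ≡ (a ∧ (b ∧ d)) ∧ c
    reassociate true  true  true  true  = refl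
    reassociate true  true  true  false = refl
    reassociate true  true  false d     = sym (BoolP.∧-zeroʳ d)
    reassociate true  false c     d     = refl
    reassociate false b     c     d     = refl

  -- every clique through the simplicial vertex v is v plus a subset of its neighbourhood
  cliquesIn-simplicial : ∀ W v → W v ≡ true → Simplicial W v →
    ∀ j → cliquesIn W (suc j) ≡ cliquesIn (remove v W) (suc j) + card (neighboursIn W v) C j
  cliquesIn-simplicial W v Wv simplicial j = begin
    cliquesIn W (suc j)
      ≡⟨ count-split F (λ S → lookup S v) (allSubsets n) ⟩
    countSubsets n (λ S → F S ∧ lookup S v) + countSubsets n (λ S → F S ∧ not (lookup S v))
      ≡⟨ ℕP.+-comm (countSubsets n (λ S → F S ∧ lookup S v)) _ ⟩
    countSubsets n (λ S → F S ∧ not (lookup S v)) + countSubsets n (λ S → F S ∧ lookup S v)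
      ≡⟨ cong₂ _+_ (countSubsets-cong n avoiding) (countSubsets-cong n (λ S → BoolP.∧-comm (F S) (lookup S v))) ⟩
    cliquesIn (remove v W) (suc j) + countSubsets n (λ S → lookup S v ∧ F S)
      ≡⟨ cong (λ s → cliquesIn (remove v W) (suc j) + s) (countSubsets-∋ n v F) ⟩
    cliquesIn (remove v W) (suc j) + countSubsets n (λ S → not (lookup S v) ∧ F (S [ v ]≔ true))
      ≡⟨ cong (λ s → cliquesIn (remove v W) (suc j) + s)
              (countSubsets-cong n (λ S → cliques-through W v S j Wv simplicial)) ⟩
    cliquesIn (remove v W) (suc j) + countSubsets n (λ S → (S ⊆ᵇ neighboursIn W v) ∧ (∣ S ∣ ≡ᵇ j))
      ≡⟨ cong (λ s → cliquesIn (remove v W) (suc j) + s) (countSubsets-⊆-size n (neighboursIn W v) j) ⟩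
    cliquesIn (remove v W) (suc j) + card (neighboursIn W v) C j ∎
    where
    open ≡-Reasoning
    F : Subset n → Bool
    F S = (isCliqueᵇ S ∧ (S ⊆ᵇ W)) ∧ (∣ S ∣ ≡ᵇ suc j)
    avoiding : ∀ S → F S ∧ not (lookup S v) ≡ (isCliqueᵇ S ∧ (S ⊆ᵇ remove v W)) ∧ (∣ S ∣ ≡ᵇ suc j)
    avoiding S = trans (reassociate (isCliqueᵇ S) (S ⊆ᵇ W) _ _)
                       (cong (λ b → (isCliqueᵇ S ∧ b) ∧ (∣ S ∣ ≡ᵇ suc j)) (sym (⊆ᵇ-remove S v W)))

  tabulate-clique : ∀ Q → IsCliqueᵛ Q → IsClique G (tabulate Q)
  tabulate-clique Q clique x y x∈Q y∈Q = clique x y (∈-tabulate⇒ x∈Q) (∈-tabulate⇒ y∈Q)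

  card-clique-≤ : ∀ {d} → (∀ S → IsClique G S → ∣ S ∣ ≤ d) → ∀ Q → IsCliqueᵛ Q → card Q ≤ d
  card-clique-≤ bound Q clique = subst (_≤ _) (∣tabulate∣ Q) (bound (tabulate Q) (tabulate-clique Q clique))

  insert-clique : ∀ Q v → IsCliqueᵛ Q → (∀ x → Q x ≡ true → Adj G v x) → IsCliqueᵛ (insert v Q)
  insert-clique Q v clique v~Q x y x∈ y∈ x≢y with ∨-elim (Q x) x∈ | ∨-elim (Q y) y∈
  ... | inj₁ Qx  | inj₁ Qy  = clique x y Qx Qy x≢y
  ... | inj₁ Qx  | inj₂ y≡v = subst (Adj G x) (sym (≟ᵇ-true⇒ y≡v)) (Adj-sym G (v~Q x Qx))
  ... | inj₂ x≡v | inj₁ Qy  = subst (λ z → Adj G z y) (sym (≟ᵇ-true⇒ x≡v)) (v~Q y Qy)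
  ... | inj₂ x≡v | inj₂ y≡v = contradiction (trans (≟ᵇ-true⇒ x≡v) (sym (≟ᵇ-true⇒ y≡v))) x≢y

  simplicial⇒closed-neighbourhood-clique : ∀ W v → Simplicial W v → IsCliqueᵛ (insert v (neighboursIn W v))
  simplicial⇒closed-neighbourhood-clique W v simplicial = insert-clique (neighboursIn W v) v
    (λ x y Nx Ny → simplicial x y (∧-elimʳ (adj G v x) Nx) (∧-elimʳ (adj G v y) Ny)
                                  (∧-elimˡ (adj G v x) Nx) (∧-elimˡ (adj G v y) Ny))
    (λ x Nx → ∧-elimˡ (adj G v x) Nx)

  cliquesIn-clique : ∀ Q → IsCliqueᵛ Q → ∀ j → cliquesIn Q j ≡ card Q C j
  cliquesIn-clique Q clique j = trans
    (countSubsets-cong n (λ S → cong (_∧ (∣ S ∣ ≡ᵇ j))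
      (≡-from-⇔ (∧-elimʳ (isCliqueᵇ S))
                (λ S⊆Q → ∧-intro (dec-true (isClique? G S) (λ x y x∈S y∈S →
                           clique x y (⊆ᵇ-elim S Q S⊆Q x∈S) (⊆ᵇ-elim S Q S⊆Q y∈S))) S⊆Q))))
    (countSubsets-⊆-size n Q j)

  cliquesIn-∅ : ∀ j → cliquesIn (λ _ → false) (suc j) ≡ 0
  cliquesIn-∅ j = trans (countSubsets-cong n none) (countSubsets-false n)
    where
    empty : ∀ {m} (S : Subset m) → S ⊆ᵇ (λ _ → false) ≡ true → ∣ S ∣ ≡ 0
    empty []          _   = refl
    empty (false ∷ S) S⊆∅ = empty S S⊆∅
    none : ∀ S → (isCliqueᵇ S ∧ (S ⊆ᵇ (λ _ → false))) ∧ (∣ S ∣ ≡ᵇ suc j) ≡ false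
    none S with true-or-false (S ⊆ᵇ (λ _ → false))
    ... | inj₁ S⊆∅ = trans (cong ((isCliqueᵇ S ∧ (S ⊆ᵇ (λ _ → false))) ∧_) (cong (_≡ᵇ suc j) (empty S S⊆∅)))
                           (BoolP.∧-zeroʳ _)
    ... | inj₂ S⊈∅ = trans (cong (λ b → (isCliqueᵇ S ∧ b) ∧ (∣ S ∣ ≡ᵇ suc j)) S⊈∅)
                           (cong (_∧ (∣ S ∣ ≡ᵇ suc j)) (BoolP.∧-zeroʳ (isCliqueᵇ S)))

module Walks {n} (G : Graph n) where

  data Walk (P : VSet n) : Fin n → Fin n → Set where
    here : ∀ {u} → P u ≡ true → Walk P u u
    step : ∀ {u w v} → P u ≡ true → Adj G u w → Walk P w v → Walk P u v

  walk-start : ∀ {P u x} → Walk P u x → P u ≡ true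
  walk-start (here Pu)     = Pu
  walk-start (step Pu _ _) = Pu

  walk-snoc : ∀ {P u z x} → Walk P u z → Adj G z x → P x ≡ true → Walk P u x
  walk-snoc (here Pu)        zx Px = step Pu zx (here Px)
  walk-snoc (step Pu uw wlk) zx Px = step Pu uw (walk-snoc wlk zx Px)

  walk-++ : ∀ {P u z x} → Walk P u z → Walk P z x → Walk P u x
  walk-++ (here _)         wlk′ = wlk′
  walk-++ (step Pu uw wlk) wlk′ = step Pu uw (walk-++ wlk wlk′)

  walk-reverse : ∀ {P u x} → Walk P u x → Walk P x u
  walk-reverse (here Pu)        = here Pu
  walk-reverse (step Pu uw wlk) = walk-snoc (walk-reverse wlk) (Adj-sym G uw) Pu

  walk-mono : ∀ {P Q u x} → (∀ z → P z ≡ true → Q z ≡ true) → Walk P u x → Walk Q u x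
  walk-mono P⊆Q (here Pu)        = here (P⊆Q _ Pu)
  walk-mono P⊆Q (step Pu uw wlk) = step (P⊆Q _ Pu) uw (walk-mono P⊆Q wlk)

  walk-closed : ∀ {P u x} (Z : VSet n) → (∀ z w → Z z ≡ true → P w ≡ true → Adj G z w → Z w ≡ true) →
    Walk P u x → Z u ≡ true → Z x ≡ true
  walk-closed Z closed (here _)        Zu = Zu
  walk-closed Z closed (step _ uw wlk) Zu = walk-closed Z closed wlk (closed _ _ Zu (walk-start wlk) uw)

  walk⇒sequence : ∀ {P u v} → Walk P u v → Σ ℕ λ r → Σ (ℕ → Fin n) λ f →
    f 0 ≡ u × f r ≡ v × (∀ t → t < r → Adj G (f t) (f (suc t))) × (∀ t → t ≤ r → P (f t) ≡ true)
  walk⇒sequence {u = u} (here Pu) = 0 , (λ _ → u) , refl , refl , (λ t ()) , (λ t _ → Pu)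
  walk⇒sequence {u = u} (step Pu uw wlk) with walk⇒sequence wlk
  ... | r , f , f0 , fr , edge , inP = suc r , g , refl , fr , edge′ , inP′
    where
    g : ℕ → Fin n
    g zero    = u
    g (suc t) = f t
    edge′ : ∀ t → t < suc r → Adj G (g t) (g (suc t))
    edge′ zero    _     = subst (Adj G u) (sym f0) uw
    edge′ (suc t) t<1+r = edge t (ℕP.≤-pred t<1+r)
    inP′ : ∀ t → t ≤ suc r → _
    inP′ zero    _     = Pu
    inP′ (suc t) t≤1+r = inP t (ℕP.≤-pred t≤1+r)

  -- the component of s in the subgraph induced by Y, computed by breadth-first search
  module Component (Y : VSet n) (s : Fin n) (Ys : Y s ≡ true) where

    private
      within : ℕ → VSet n
      within zero    x = x ≟ᵇ s
      within (suc t) x = within t x ∨ (Y x ∧ anyᵇ (λ z → within t z ∧ adj G z x))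

      within-suc : ∀ t x → within t x ≡ true → within (suc t) x ≡ true
      within-suc t x = ∨-introˡ _

      within-⊆ : ∀ t x → within t x ≡ true → Y x ≡ true
      within-⊆ zero    x x≡s = subst (λ z → Y z ≡ true) (sym (≟ᵇ-true⇒ x≡s)) Ys
      within-⊆ (suc t) x p with ∨-elim (within t x) p
      ... | inj₁ old = within-⊆ t x old
      ... | inj₂ new = ∧-elimˡ (Y x) new

      within-walk : ∀ t x → within t x ≡ true → Walk (within t) s x
      within-walk zero    x x≡s = subst (Walk (within zero) s) (sym (≟ᵇ-true⇒ x≡s)) (here (≟ᵇ-refl s))
      within-walk (suc t) x p with ∨-elim (within t x) p
      ... | inj₁ old = walk-mono (within-suc t) (within-walk t x old)
      ... | inj₂ new = let (z , zx) = anyᵇ-elim (λ z → within t z ∧ adj G z x) (∧-elimʳ (Y x) new)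
                       in walk-snoc (walk-mono (within-suc t) (within-walk t z (∧-elimˡ (within t z) zx)))
                                    (∧-elimʳ (within t z) zx) p

      Stable : ℕ → Set
      Stable t = ∀ x → within (suc t) x ≡ true → within t x ≡ true

      stable? : ∀ t → Dec (Stable t)
      stable? t = FinP.all? (λ x → (within (suc t) x Bool.≟ true) →-dec (within t x Bool.≟ true))

      stable-suc : ∀ t → Stable t → Stable (suc t)
      stable-suc t st x p with ∨-elim (within (suc t) x) p
      ... | inj₁ old = old
      ... | inj₂ new =
        let (z , zx) = anyᵇ-elim (λ z → within (suc t) z ∧ adj G z x) (∧-elimʳ (Y x) new)
        in ∨-introʳ (within t x) (∧-intro (∧-elimˡ (Y x) new)
             (anyᵇ-intro _ z (∧-intro (st z (∧-elimˡ (within (suc t) z) zx)) (∧-elimʳ (within (suc t) z) zx))))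

      unstable-grows : ∀ t → ¬ Stable t → card (within t) < card (within (suc t))
      unstable-grows t unstable
        with FinP.¬∀⟶∃¬ n _ (λ x → (within (suc t) x Bool.≟ true) →-dec (within t x Bool.≟ true)) unstable
      ... | (x , ¬x) with true-or-false (within t x) | true-or-false (within (suc t) x)
      ...   | inj₁ old | _         = contradiction (λ _ → old) ¬x
      ...   | inj₂ _   | inj₂ out  = contradiction (λ new → contradiction new (λ new′ → true≢false new′ out)) ¬x
      ...   | inj₂ out | inj₁ new  = card-strict (within t) (within (suc t)) (within-suc t) x new out

      stable-or-large : ∀ t → Stable t ⊎ suc t ≤ card (within (suc t))
      stable-or-large zero with stable? zero
      ... | yes st = inj₁ st
      ... | no ¬st = inj₂ (ℕP.≤-trans (s≤s z≤n) (unstable-grows zero ¬st))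
      stable-or-large (suc t) with stable? (suc t)
      ... | yes st = inj₁ st
      ... | no ¬st with stable-or-large t
      ...   | inj₁ st    = contradiction (stable-suc t st) ¬st
      ...   | inj₂ large = inj₂ (ℕP.<-≤-trans (s≤s large) (unstable-grows (suc t) ¬st))

      stable-n : Stable n
      stable-n with stable-or-large n
      ... | inj₁ st    = st
      ... | inj₂ large = contradiction (ℕP.<-≤-trans large (card≤n (within (suc n)))) (ℕP.<-irrefl refl)

    component : VSet n
    component = within n

    component-∋ : component s ≡ true
    component-∋ = contains n
      where contains : ∀ t → within t s ≡ true
            contains zero    = ≟ᵇ-refl s
            contains (suc t) = within-suc t s (contains t)

    component-⊆ : ∀ x → component x ≡ true → Y x ≡ true
    component-⊆ = within-⊆ n

    component-walk : ∀ x → component x ≡ true → Walk component s x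
    component-walk = within-walk n

    component-closed : ∀ x y → component x ≡ true → Y y ≡ true → Adj G x y → component y ≡ true
    component-closed x y Cx Yy xy =
      stable-n y (∨-introʳ (within n y) (∧-intro Yy (anyᵇ-intro _ x (∧-intro Cx xy))))

module Detours {n} (G : Graph n) (chordal : Chordal G) (a x y : Fin n) (B : VSet n)
  (ax : Adj G a x) (ay : Adj G a y) (x≢y : x ≢ y) (x≁y : adj G x y ≡ false)
  (a≁B : ∀ z → B z ≡ true → adj G a z ≡ false) (a∉B : B a ≡ false) where

  record Detour (r : ℕ) (f : ℕ → Fin n) : Set where
    field
      start : f 0 ≡ y
      end   : f r ≡ x
      edge  : ∀ t → t < r → Adj G (f t) (f (suc t))
      inner : ∀ t → 0 < t → t < r → B (f t) ≡ true
  open Detour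

  -- drop the k + 1 vertices strictly between positions i and i + k + 2
  shortcut : ∀ {r f} → Detour r f → ∀ i k r′ → r ≡ r′ + suc k → i < r′ →
    Adj G (f i) (f (suc i + suc k)) → Σ (ℕ → Fin n) (Detour r′)
  shortcut {r} {f} det i k r′ r≡ i<r′ link = g , record
    { start = trans (g-≤ 0 z≤n) (start det)
    ; end   = trans (g-> r′ i<r′) (trans (cong f (sym r≡)) (end det))
    ; edge  = edge′
    ; inner = inner′
    }
    where
    g : ℕ → Fin n
    g t = if t <ᵇ suc i then f t else f (t + suc k)
    g-≤ : ∀ t → t ≤ i → g t ≡ f t
    g-≤ t t≤i rewrite <ᵇ-true (s≤s t≤i) = refl
    g-> : ∀ t → i < t → g t ≡ f (t + suc k)
    g-> t i<t rewrite <ᵇ-false {t} {suc i} i<t = refl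
    r′≤r : r′ ≤ r
    r′≤r = subst (r′ ≤_) (sym r≡) (ℕP.m≤m+n r′ (suc k))
    shifted< : ∀ {t} → t < r′ → t + suc k < r
    shifted< t<r′ = subst (_ <_) (sym r≡) (ℕP.+-monoˡ-< (suc k) t<r′)
    edge′ : ∀ t → t < r′ → Adj G (g t) (g (suc t))
    edge′ t t<r′ with ℕP.<-cmp t i
    ... | tri< t<i _ _  = subst₂ (Adj G) (sym (g-≤ t (ℕP.<⇒≤ t<i))) (sym (g-≤ (suc t) t<i))
                                 (edge det t (ℕP.<-≤-trans t<r′ r′≤r))
    ... | tri≈ _ refl _ = subst₂ (Adj G) (sym (g-≤ t ℕP.≤-refl)) (sym (g-> (suc t) ℕP.≤-refl)) link
    ... | tri> _ _ i<t  = subst₂ (Adj G) (sym (g-> t i<t)) (sym (g-> (suc t) (ℕP.m<n⇒m<1+n i<t)))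
                                 (edge det (t + suc k) (shifted< t<r′))
    inner′ : ∀ t → 0 < t → t < r′ → B (g t) ≡ true
    inner′ t 0<t t<r′ with ℕP.≤-<-connex t i
    ... | inj₁ t≤i = subst (λ u → B u ≡ true) (sym (g-≤ t t≤i)) (inner det t 0<t (ℕP.<-≤-trans t<r′ r′≤r))
    ... | inj₂ i<t = subst (λ u → B u ≡ true) (sym (g-> t i<t))
                       (inner det (t + suc k) (ℕP.<-≤-trans 0<t (ℕP.m≤m+n t (suc k))) (shifted< t<r′))

  Chord : (ℕ → Fin n) → ℕ → ℕ → Set
  Chord f i j = suc (suc i) ≤ j × (f i ≡ f j ⊎ Adj G (f i) (f j))

  Induced : ℕ → (ℕ → Fin n) → Set
  Induced r f = ∀ i j → suc (suc i) ≤ j → j ≤ r → f i ≢ f j × adj G (f i) (f j) ≡ false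

  induced-or-chord : ∀ r f → Induced r f ⊎ Σ ℕ λ i → Σ ℕ λ j → j ≤ r × Chord f i j
  induced-or-chord r f with FinP.any? (λ (I : Fin (suc r)) → FinP.any? (λ (J : Fin (suc r)) → chord? (toℕ I) (toℕ J)))
    where
    chord? : ∀ i j → Dec (Chord f i j)
    chord? i j = (suc (suc i) Nat.≤? j) ×-dec ((f i Fin.≟ f j) ⊎-dec (adj G (f i) (f j) Bool.≟ true))
  ... | yes (I , J , chord) = inj₂ (toℕ I , toℕ J , ℕP.≤-pred (FinP.toℕ<n J) , chord)
  ... | no ¬chord = inj₁ induced
    where
    no-chord : ∀ i j → i < suc r → j < suc r → ¬ Chord f i j
    no-chord i j i≤r j≤r chord = ¬chord (fromℕ< i≤r , fromℕ< j≤r ,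
      subst₂ (Chord f) (sym (FinP.toℕ-fromℕ< i≤r)) (sym (FinP.toℕ-fromℕ< j≤r)) chord)
    induced : Induced r f
    induced i j i+2≤j j≤r = (λ fi≡fj → no-chord i j i≤r (s≤s j≤r) (i+2≤j , inj₁ fi≡fj)) , not-adjacent
      where
      i≤r : i < suc r
      i≤r = s≤s (ℕP.≤-trans (ℕP.≤-trans (ℕP.n≤1+n i) (ℕP.n≤1+n (suc i))) (ℕP.≤-trans i+2≤j j≤r))
      not-adjacent : adj G (f i) (f j) ≡ false
      not-adjacent with adj G (f i) (f j) in fi~fj
      ... | true  = contradiction (i+2≤j , inj₂ fi~fj) (no-chord i j i≤r (s≤s j≤r))
      ... | false = refl

  -- a, f 0, …, f r is then a chordless cycle of length r + 2 ≥ 4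
  module InducedCycle (r₀ : ℕ) (f : ℕ → Fin n) (det : Detour (suc (suc r₀)) f) (induced : Induced (suc (suc r₀)) f) where
    r m : ℕ
    r = suc (suc r₀)
    m = suc (suc r)

    vertex : ℕ → Fin n
    vertex zero    = a
    vertex (suc t) = f t

    cycle : Fin m → Fin n
    cycle p = vertex (toℕ p)

    a≢f : ∀ t → t ≤ r → a ≢ f t
    a≢f t t≤r a≡ft with t Nat.≟ 0 | t Nat.≟ r
    ... | yes refl | _        = Adj-irrefl G (subst (Adj G a) (sym (trans a≡ft (start det))) ay)
    ... | no _     | yes refl = Adj-irrefl G (subst (Adj G a) (sym (trans a≡ft (end det))) ax)
    ... | no t≢0   | no t≢r   = true≢false (subst (λ z → B z ≡ true) (sym a≡ft)
                                  (inner det t (ℕP.n≢0⇒n>0 t≢0) (ℕP.≤∧≢⇒< t≤r t≢r))) a∉B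

    f-injective : ∀ s t → s < t → t ≤ r → f s ≢ f t
    f-injective s t s<t t≤r fs≡ft with t Nat.≟ suc s
    ... | yes refl = Adj-irrefl G (subst (Adj G (f s)) (sym fs≡ft) (edge det s t≤r))
    ... | no t≢1+s = proj₁ (induced s t (ℕP.≤∧≢⇒< s<t (t≢1+s ∘ sym)) t≤r) fs≡ft

    vertex-injective : ∀ s t → s < t → t ≤ suc r → vertex s ≢ vertex t
    vertex-injective zero    (suc t) _   t≤ = a≢f t (ℕP.≤-pred t≤)
    vertex-injective (suc s) (suc t) s<t t≤ = f-injective s t (ℕP.≤-pred s<t) (ℕP.≤-pred t≤)

    cycle-injective : ∀ p q → cycle p ≡ cycle q → p ≡ q
    cycle-injective p q same = FinP.toℕ-injective toℕ-same
      where
      toℕ-same : toℕ p ≡ toℕ q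
      toℕ-same with ℕP.<-cmp (toℕ p) (toℕ q)
      ... | tri< p<q _ _ = contradiction same (vertex-injective _ _ p<q (ℕP.≤-pred (FinP.toℕ<n q)))
      ... | tri≈ _ p≡q _ = p≡q
      ... | tri> _ _ q<p = contradiction (sym same) (vertex-injective _ _ q<p (ℕP.≤-pred (FinP.toℕ<n p)))

    vertex-edge : ∀ s → s < suc r → Adj G (vertex s) (vertex (suc s))
    vertex-edge zero    _     = subst (Adj G a) (sym (start det)) ay
    vertex-edge (suc s) s<1+r = edge det s (ℕP.≤-pred s<1+r)

    cycle-edge : ∀ p q → CycNext m p q → Adj G (cycle p) (cycle q)
    cycle-edge p q (inj₁ q≡1+p) rewrite q≡1+p =
      vertex-edge (toℕ p) (ℕP.≤-pred (subst (_< m) q≡1+p (FinP.toℕ<n q)))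
    cycle-edge p q (inj₂ (p≡last , q≡0)) rewrite q≡0 | ℕP.suc-injective p≡last =
      Adj-sym G (subst (Adj G a) (sym (end det)) ax)

    Consecutive : ℕ → ℕ → Set
    Consecutive s t = t ≡ suc s ⊎ (suc s ≡ m × t ≡ 0)

    only-cycle-edges : ∀ s t → s ≤ suc r → t ≤ suc r → s ≢ t → Adj G (vertex s) (vertex t) →
      Consecutive s t ⊎ Consecutive t s
    only-cycle-edges zero zero _ _ s≢t _ = contradiction refl s≢t
    only-cycle-edges zero (suc t) _ t≤ _ a~ft with t Nat.≟ 0 | t Nat.≟ r
    ... | yes refl | _        = inj₁ (inj₁ refl)
    ... | no _     | yes refl = inj₂ (inj₂ (refl , refl))
    ... | no t≢0   | no t≢r   =
      contradiction (a≁B (f t) (inner det t (ℕP.n≢0⇒n>0 t≢0) (ℕP.≤∧≢⇒< (ℕP.≤-pred t≤) t≢r)))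
                    (true≢false a~ft)
    only-cycle-edges (suc s) zero s≤ t≤ s≢t fs~a with only-cycle-edges zero (suc s) t≤ s≤ (s≢t ∘ sym) (Adj-sym G fs~a)
    ... | inj₁ c = inj₂ c
    ... | inj₂ c = inj₁ c
    only-cycle-edges (suc s) (suc t) s≤ t≤ s≢t fs~ft with ℕP.<-cmp s t
    ... | tri≈ _ refl _ = contradiction refl s≢t
    ... | tri< s<t _ _ with t Nat.≟ suc s
    ...   | yes refl   = inj₁ (inj₁ refl)
    ...   | no t≢1+s   = contradiction fs~ft
                           (λ p → true≢false p (proj₂ (induced s t (ℕP.≤∧≢⇒< s<t (t≢1+s ∘ sym)) (ℕP.≤-pred t≤))))
    only-cycle-edges (suc s) (suc t) s≤ t≤ s≢t fs~ft | tri> _ _ t<s with s Nat.≟ suc t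
    ...   | yes refl   = inj₂ (inj₁ refl)
    ...   | no s≢1+t   = contradiction (Adj-sym G fs~ft)
                           (λ p → true≢false p (proj₂ (induced t s (ℕP.≤∧≢⇒< t<s (s≢1+t ∘ sym)) (ℕP.≤-pred s≤))))

    absurd : ⊥
    absurd with chordal m (s≤s (s≤s (s≤s (s≤s z≤n)))) cycle ((λ {p} {q} → cycle-injective p q) , cycle-edge)
    ... | (p , q , p≢q , ¬p→q , ¬q→p , p~q)
      with only-cycle-edges (toℕ p) (toℕ q) (ℕP.≤-pred (FinP.toℕ<n p)) (ℕP.≤-pred (FinP.toℕ<n q))
                            (p≢q ∘ FinP.toℕ-injective) p~q
    ...   | inj₁ p→q = ¬p→q p→q
    ...   | inj₂ q→p = ¬q→p q→p

  x∉B : B x ≡ true → ⊥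
  x∉B Bx = true≢false ax (a≁B x Bx)

  induced-impossible : ∀ r f → Detour r f → Induced r f → ⊥
  induced-impossible zero           f det _       = x≢y (trans (sym (end det)) (start det))
  induced-impossible (suc zero)     f det _       =
    true≢false (subst₂ (Adj G) (start det) (end det) (edge det 0 (s≤s z≤n))) (trans (Graph.sym G y x) x≁y)
  induced-impossible (suc (suc r₀)) f det induced = InducedCycle.absurd r₀ f det induced

  x-only-at-end : ∀ {r f} → Detour r f → ∀ i → i < r → f i ≢ x
  x-only-at-end det zero    _   f0≡x = x≢y (trans (sym f0≡x) (start det))
  x-only-at-end det (suc i) i<r fi≡x = x∉B (subst (λ z → B z ≡ true) fi≡x (inner det (suc i) (s≤s z≤n) i<r))

  chord-shortens : ∀ {r f} → Detour r f → ∀ i j → j ≤ r → Chord f i j →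
    Σ ℕ λ r′ → r′ < r × Σ (ℕ → Fin n) (Detour r′)
  chord-shortens {r} {f} det i j j≤r (i+2≤j , inj₂ fi~fj)
    with ℕP.m≤n⇒∃[o]m+o≡n i+2≤j | ℕP.m≤n⇒∃[o]m+o≡n j≤r
  ... | (u , i+2+u≡j) | (w , j+w≡r) = r′ , r′<r , shortcut det i u r′ r≡ (s≤s (ℕP.m≤m+n i w)) link
    where
    r′ : ℕ
    r′ = suc i + w
    r≡ : r ≡ r′ + suc u
    r≡ = trans (sym j+w≡r) (trans (cong (_+ w) (sym i+2+u≡j)) (regroup i u w))
      where regroup : ∀ i u w → suc (suc i) + u + w ≡ suc i + w + suc u
            regroup = ℕ-Solver.solve-∀
    r′<r : r′ < r
    r′<r = subst (r′ <_) (sym r≡) (ℕP.m<m+n r′ (s≤s z≤n))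
    link : Adj G (f i) (f (suc i + suc u))
    link = subst (λ z → Adj G (f i) (f z)) (trans (sym i+2+u≡j) (cong suc (sym (ℕP.+-suc i u)))) fi~fj
  chord-shortens {r} {f} det i j j≤r (i+2≤j , inj₁ fi≡fj) with j Nat.<? r
  ... | yes j<r = chord-shortens det i (suc j) j<r
                    (ℕP.m≤n⇒m≤1+n i+2≤j , inj₂ (subst (λ z → Adj G z (f (suc j))) (sym fi≡fj) (edge det j j<r)))
  ... | no j≮r = ⊥-elim (x-only-at-end det i (ℕP.<-≤-trans (s≤s (ℕP.n≤1+n i)) (ℕP.≤-trans i+2≤j j≤r))
                    (trans fi≡fj (trans (cong f (ℕP.≤-antisym j≤r (ℕP.≮⇒≥ j≮r))) (end det))))

  no-detour : ∀ r f → Detour r f → ⊥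
  no-detour = <-rec (λ r → ∀ f → Detour r f → ⊥) λ r shorter f det → case induced-or-chord r f of λ where
    (inj₁ induced)               → induced-impossible r f det induced
    (inj₂ (i , j , j≤r , chord)) → let (r′ , r′<r , g , det′) = chord-shortens det i j j≤r chord
                                   in shorter r′<r g det′

  no-walk-between-neighbours : ∀ {zx zy} → Adj G x zx → Adj G y zy → Walks.Walk G B zy zx → ⊥
  no-walk-between-neighbours {zx} {zy} x~zx y~zy wlk with Walks.walk⇒sequence G wlk
  ... | (r , f , f0 , fr , f-edge , f∈B) = no-detour (suc (suc r)) g (record
    { start = refl ; end = g-end r refl ; edge = g-edge ; inner = g-inner })
    where
    g : ℕ → Fin n
    g zero    = y
    g (suc t) = if t <ᵇ suc r then f t else x
    g-≤ : ∀ t → t ≤ r → g (suc t) ≡ f t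
    g-≤ t t≤r rewrite <ᵇ-true (s≤s t≤r) = refl
    g-end : ∀ t → t ≡ r → g (suc (suc t)) ≡ x
    g-end t refl rewrite <ᵇ-false {suc t} {suc t} ℕP.≤-refl = refl
    g-edge : ∀ t → t < suc (suc r) → Adj G (g t) (g (suc t))
    g-edge zero    _ = subst (Adj G y) (sym (trans (g-≤ 0 z≤n) f0)) y~zy
    g-edge (suc t) t<r+2 with ℕP.m≤n⇒m<n∨m≡n (ℕP.≤-pred (ℕP.≤-pred t<r+2))
    ... | inj₁ t<r  = subst₂ (Adj G) (sym (g-≤ t (ℕP.<⇒≤ t<r))) (sym (g-≤ (suc t) t<r)) (f-edge t t<r)
    ... | inj₂ t≡r = subst₂ (Adj G) (sym (trans (g-≤ t (ℕP.≤-reflexive t≡r)) (trans (cong f t≡r) fr)))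
                                   (sym (g-end t t≡r)) (Adj-sym G x~zx)
    g-inner : ∀ t → 0 < t → t < suc (suc r) → B (g t) ≡ true
    g-inner (suc t) _ t<r+2 = subst (λ z → B z ≡ true) (sym (g-≤ t (ℕP.≤-pred (ℕP.≤-pred t<r+2))))
                                     (f∈B t (ℕP.≤-pred (ℕP.≤-pred t<r+2)))

module Dirac {n} (G : Graph n) (chordal : Chordal G) where
  open Cliques G
  open Walks G

  SimplicialOutside : VSet n → VSet n → Set
  SimplicialOutside W Q = Σ (Fin n) λ v → W v ≡ true × Q v ≡ false × Simplicial W v

  simplicial-mono : ∀ W W′ v → (∀ u → W u ≡ true → Adj G v u → W′ u ≡ true) → Simplicial W′ v → Simplicial W v
  simplicial-mono W W′ v N⊆W′ simplicial x y Wx Wy vx vy = simplicial x y (N⊆W′ x Wx vx) (N⊆W′ y Wy vy) vx vy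

  module Step (W Q : VSet n) (Q-clique : IsCliqueᵛ Q)
    (IH : ∀ W′ → card W′ < card W → ∀ Q′ w → IsCliqueᵛ Q′ → W′ w ≡ true → Q′ w ≡ false →
          SimplicialOutside W′ Q′)
    (a b : Fin n) (Wa : W a ≡ true) (Wb : W b ≡ true) (a≢b : a ≢ b) (a≁b : adj G a b ≡ false) where

    far : VSet n
    far x = W x ∧ (not (adj G a x) ∧ not (x ≟ᵇ a))

    far-b : far b ≡ true
    far-b = ∧-intro Wb (∧-intro (not-false a≁b) (not-false (≟ᵇ-≢ (a≢b ∘ sym))))

    module CB = Component far b far-b
    B : VSet n
    B = CB.component

    B⊆W : ∀ z → B z ≡ true → W z ≡ true
    B⊆W z Bz = ∧-elimˡ (W z) (CB.component-⊆ z Bz)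

    a≁B : ∀ z → B z ≡ true → adj G a z ≡ false
    a≁B z Bz = not-true (∧-elimˡ (not (adj G a z)) (∧-elimʳ (W z) (CB.component-⊆ z Bz)))

    a∉B : B a ≡ false
    a∉B with B a in Ba
    ... | false = refl
    ... | true  = contradiction (≟ᵇ-refl a)
                    (λ a≡a → true≢false a≡a (not-true (∧-elimʳ (not (adj G a a)) (∧-elimʳ (W a) (CB.component-⊆ a Ba)))))

    -- the neighbours of a in W that are adjacent to B: they separate B from a
    S : VSet n
    S x = adj G a x ∧ (W x ∧ anyᵇ (λ z → B z ∧ adj G x z))

    S⊆W : ∀ x → S x ≡ true → W x ≡ true
    S⊆W x Sx = ∧-elimˡ (W x) (∧-elimʳ (adj G a x) Sx)

    S-touches-B : ∀ x → S x ≡ true → Σ (Fin n) λ z → B z ≡ true × Adj G x z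
    S-touches-B x Sx = let (z , Bz∧xz) = anyᵇ-elim (λ z → B z ∧ adj G x z) (∧-elimʳ (W x) (∧-elimʳ (adj G a x) Sx))
                       in z , ∧-elimˡ (B z) Bz∧xz , ∧-elimʳ (B z) Bz∧xz

    S⊆N[a] : ∀ x → adj G a x ≡ false → S x ≡ false
    S⊆N[a] x a≁x = cong (_∧ (W x ∧ anyᵇ (λ z → B z ∧ adj G x z))) a≁x

    a∉S : S a ≡ false
    a∉S = S⊆N[a] a (irrefl G a)

    b∉S : S b ≡ false
    b∉S = S⊆N[a] b a≁b

    S-clique : IsCliqueᵛ S
    S-clique x y Sx Sy x≢y with adj G x y in x~y
    ... | true  = refl
    ... | false =
      let (zx , Bzx , x~zx) = S-touches-B x Sx
          (zy , Bzy , y~zy) = S-touches-B y Sy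
      in ⊥-elim (Detours.no-walk-between-neighbours G chordal a x y B (∧-elimˡ (adj G a x) Sx) (∧-elimˡ (adj G a y) Sy)
                   x≢y x~y a≁B a∉B x~zx y~zy (walk-++ (walk-reverse (CB.component-walk zy Bzy)) (CB.component-walk zx Bzx)))

    W∖S : VSet n
    W∖S x = W x ∧ not (S x)

    B-closed : ∀ z u → B z ≡ true → W∖S u ≡ true → Adj G z u → B u ≡ true
    B-closed z u Bz W∖Su z~u = CB.component-closed z u Bz far-u z~u
      where
      Wu : W u ≡ true
      Wu = ∧-elimˡ (W u) W∖Su
      a≁u : adj G a u ≡ false
      a≁u with true-or-false (adj G a u)
      ... | inj₂ a≁u = a≁u
      ... | inj₁ a~u = ⊥-elim (true≢false Su (not-true (∧-elimʳ (W u) W∖Su)))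
        where Su : S u ≡ true
              Su = ∧-intro a~u (∧-intro Wu (anyᵇ-intro (λ z → B z ∧ adj G u z) z (∧-intro Bz (Adj-sym G z~u))))
      far-u : far u ≡ true
      far-u = ∧-intro Wu (∧-intro (not-false a≁u)
                (not-false (≟ᵇ-≢ {x = u} {a} λ { refl → true≢false (Adj-sym G z~u) (a≁B z Bz) })))

    module CA = Component W∖S a (∧-intro Wa (not-false a∉S))
    A : VSet n
    A = CA.component

    A∩B=∅ : ∀ z → A z ≡ true → B z ≡ false
    A∩B=∅ z Az with B z in Bz
    ... | false = refl
    ... | true  = contradiction
      (walk-closed B (λ z′ w′ Bz′ Aw′ z′w′ → B-closed z′ w′ Bz′ (CA.component-⊆ w′ Aw′) z′w′)
                   (walk-reverse (CA.component-walk z Az)) Bz) (λ Ba → true≢false Ba a∉B)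

    -- recursion on one side X ∪ S of the separator, where the clique S plays the role of Q
    side : (X : VSet n) → (∀ x → X x ≡ true → W∖S x ≡ true) →
      (∀ z u → X z ≡ true → W∖S u ≡ true → Adj G z u → X u ≡ true) →
      ∀ s → X s ≡ true → ∀ t → W t ≡ true → X t ≡ false → S t ≡ false →
      Σ (Fin n) λ v → X v ≡ true × Simplicial W v
    side X X⊆W∖S X-closed s Xs t Wt Xt St = v , Xv , simplicial-mono W X∪S v N⊆X∪S simplicial
      where
      X∪S : VSet n
      X∪S x = X x ∨ S x
      X∪S⊆W : ∀ x → X∪S x ≡ true → W x ≡ true
      X∪S⊆W x X∪Sx with ∨-elim (X x) X∪Sx
      ... | inj₁ Xx = ∧-elimˡ (W x) (X⊆W∖S x Xx)
      ... | inj₂ Sx = S⊆W x Sx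
      smaller : card X∪S < card W
      smaller = card-strict X∪S W X∪S⊆W t Wt (subst (λ b → b ∨ S t ≡ false) (sym Xt) St)
      found : SimplicialOutside X∪S S
      found = IH X∪S smaller S s S-clique (∨-introˡ (S s) Xs) (not-true (∧-elimʳ (W s) (X⊆W∖S s Xs)))
      v : Fin n
      v = proj₁ found
      simplicial : Simplicial X∪S v
      simplicial = proj₂ (proj₂ (proj₂ found))
      Xv : X v ≡ true
      Xv with ∨-elim (X v) (proj₁ (proj₂ found))
      ... | inj₁ Xv = Xv
      ... | inj₂ Sv = contradiction (proj₁ (proj₂ (proj₂ found))) (true≢false Sv)
      N⊆X∪S : ∀ u → W u ≡ true → Adj G v u → X∪S u ≡ true
      N⊆X∪S u Wu v~u with true-or-false (S u)
      ... | inj₁ Su = ∨-introʳ (X u) Su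
      ... | inj₂ Su = ∨-introˡ (S u) (X-closed v u Xv (∧-intro Wu (not-false Su)) v~u)

    result : SimplicialOutside W Q
    result with anyᵇ (λ q → Q q ∧ B q) in Q∩B
    ... | false = let (v , Bv , simplicial) = side B (λ x Bx → ∧-intro (B⊆W x Bx) (not-false (S⊆N[a] x (a≁B x Bx)))) B-closed
                                                    b CB.component-∋ a Wa a∉B a∉S
                  in v , B⊆W v Bv , Qv v Bv , simplicial
      where Qv : ∀ v → B v ≡ true → Q v ≡ false
            Qv v Bv with Q v in Qv
            ... | false = refl
            ... | true  = contradiction (anyᵇ-intro _ v (∧-intro Qv Bv)) (λ p → true≢false p Q∩B)
    ... | true = let (v , Av , simplicial) = side A CA.component-⊆ CA.component-closed a CA.component-∋ b Wb A∌b b∉S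
                 in v , ∧-elimˡ (W v) (CA.component-⊆ v Av) , Qv v Av , simplicial
      where
      A∌b : A b ≡ false
      A∌b with A b in Ab
      ... | false = refl
      ... | true  = contradiction CB.component-∋ (λ Bb → true≢false Bb (A∩B=∅ b Ab))
      -- Q meets B; since Q is a clique, any vertex of Q outside B would be adjacent to B, so in B
      Qv : ∀ v → A v ≡ true → Q v ≡ false
      Qv v Av with Q v in Qv | anyᵇ-elim (λ q → Q q ∧ B q) Q∩B
      ... | false | _           = refl
      ... | true  | (q , Qq∧Bq) = contradiction (B-closed q v Bq (CA.component-⊆ v Av) (Q-clique q v Qq Qv q≢v))
                                                (λ Bv → true≢false Bv (A∩B=∅ v Av))
        where
        Qq : Q q ≡ true
        Qq = ∧-elimˡ (Q q) Qq∧Bq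
        Bq : B q ≡ true
        Bq = ∧-elimʳ (Q q) Qq∧Bq
        q≢v : q ≢ v
        q≢v q≡v = true≢false (subst (λ z → B z ≡ true) q≡v Bq) (A∩B=∅ v Av)

  simplicial-outside-clique : ∀ W Q w → IsCliqueᵛ Q → W w ≡ true → Q w ≡ false → SimplicialOutside W Q
  simplicial-outside-clique W = by-size (card W) W refl
    where
    Claim : ℕ → Set
    Claim k = ∀ W → card W ≡ k → ∀ Q w → IsCliqueᵛ Q → W w ≡ true → Q w ≡ false → SimplicialOutside W Q
    by-size : ∀ k → Claim k
    by-size = <-rec Claim λ k IH W card≡k Q w Q-clique Ww Qw → case isCliqueᵛ? W of λ where
      (yes W-clique) → w , Ww , Qw , λ x y Wx Wy _ _ → W-clique x y Wx Wy
      (no ¬W-clique) →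
        let (a , b , Wa , Wb , a≢b , a≁b) = ¬IsCliqueᵛ⇒nonadjacent W ¬W-clique
        in Step.result W Q Q-clique (λ W′ smaller → IH (subst (card W′ <_) card≡k smaller) W′ refl) a b Wa Wb a≢b a≁b

avoiding : ∀ {n} → VSet n → Subset n → VSet n
avoiding W X z = W z ∧ not (lookup X z)

KConnectedIn : ℕ → ∀ {n} → Graph n → VSet n → Set
KConnectedIn k {n} G W = ∀ (X : Subset n) → ∣ X ∣ < k → ∀ u w → W u ≡ true → W w ≡ true →
  lookup X u ≡ false → lookup X w ≡ false → Walks.Walk G (avoiding W X) u w

module Rerouting {n} (G : Graph n) (W : VSet n) (v : Fin n) (simplicial : Cliques.Simplicial G W v) (X : Subset n) where
  open Walks G

  private
    keep : ∀ {u} → avoiding W X u ≡ true → u ≟ᵇ v ≡ false → avoiding (remove v W) X u ≡ true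
    keep {u} p u≢v = ∧-intro (∧-intro (∧-elimˡ (W u) p) (not-false u≢v)) (∧-elimʳ (W u) p)

  -- a detour u – v – s through the simplicial vertex v is replaced by the edge u – s
  mutual
    reroute : ∀ {u w} → u ≟ᵇ v ≡ false → w ≟ᵇ v ≡ false →
      Walk (avoiding W X) u w → Walk (avoiding (remove v W) X) u w
    reroute u≢v w≢v (here p) = here (keep p u≢v)
    reroute u≢v w≢v (step {w = t} Pu u~t rest) with t Fin.≟ v
    ... | no  t≢v  = step (keep Pu u≢v) u~t (reroute (≟ᵇ-≢ t≢v) w≢v rest)
    ... | yes refl = through-v u≢v w≢v Pu u~t rest

    through-v : ∀ {u w} → u ≟ᵇ v ≡ false → w ≟ᵇ v ≡ false → avoiding W X u ≡ true → Adj G u v →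
      Walk (avoiding W X) v w → Walk (avoiding (remove v W) X) u w
    through-v u≢v w≢v Pu u~v (here _) = contradiction (≟ᵇ-refl v) (λ v≡v → true≢false v≡v w≢v)
    through-v {u} u≢v w≢v Pu u~v (step {w = s} _ v~s rest) with s Fin.≟ u
    ... | yes refl = reroute u≢v w≢v rest
    ... | no  s≢u  = step (keep Pu u≢v) u~s (reroute s≢v w≢v rest)
      where
      s≢v : s ≟ᵇ v ≡ false
      s≢v = ≟ᵇ-≢ {x = s} {v} λ { refl → Adj-irrefl G v~s }
      u~s : Adj G u s
      u~s = simplicial u s (∧-elimˡ (W u) Pu) (∧-elimˡ (W s) (walk-start rest)) (Adj-sym G u~v) v~s (s≢u ∘ sym)

KConnectedIn-remove : ∀ k {n} (G : Graph n) W v → Cliques.Simplicial G W v → KConnectedIn k G W → KConnectedIn k G (remove v W)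
KConnectedIn-remove k G W v simplicial connected X ∣X∣<k u w W-v∋u W-v∋w u∉X w∉X =
  Rerouting.reroute G W v simplicial X (not-true (∧-elimʳ (W u) W-v∋u)) (not-true (∧-elimʳ (W w) W-v∋w))
    (connected X ∣X∣<k u w (∧-elimˡ (W u) W-v∋u) (∧-elimˡ (W w) W-v∋w) u∉X w∉X)

neighbours-separate : ∀ {n} (G : Graph n) W v {u} → u ≟ᵇ v ≡ false →
  ¬ Walks.Walk G (avoiding W (tabulate (Cliques.neighboursIn G W v))) v u
neighbours-separate G W v u≢v (Walks.here _) = true≢false (≟ᵇ-refl v) u≢v
neighbours-separate G W v _ (Walks.step {w = t} _ v~t rest) =
  true≢false (trans (VecP.lookup∘tabulate (Cliques.neighboursIn G W v) t) (∧-intro v~t (∧-elimˡ (W t) Pt)))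
             (not-true (∧-elimʳ (W t) Pt))
  where Pt = Walks.walk-start G rest

module Elimination {n} (G : Graph n) (chordal : Chordal G) (k d : ℕ)
  (maximum : ∀ S → IsClique G S → ∣ S ∣ ≤ d) (Q : VSet n) (Q-clique : Cliques.IsCliqueᵛ G Q) (card-Q : card Q ≡ d) where
  open Cliques G
  open Dirac G chordal

  degree-< : ∀ W v → Simplicial W v → card (neighboursIn W v) < d
  degree-< W v simplicial =
    subst (_≤ d) (card-insert (neighboursIn W v) v (cong (_∧ W v) (irrefl G v)))
          (card-clique-≤ maximum _ (simplicial⇒closed-neighbourhood-clique W v simplicial))

  degree-≥ : ∀ W v → W v ≡ true → Q v ≡ false → (∀ x → Q x ≡ true → W x ≡ true) → KConnectedIn k G W →
    k ≤ card (neighboursIn W v)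
  degree-≥ W v Wv Qv Q⊆W connected with k Nat.≤? card (neighboursIn W v)
  ... | yes k≤deg = k≤deg
  ... | no  k≰deg with anyᵇ (λ u → W u ∧ (not (adj G v u) ∧ not (u ≟ᵇ v))) in non-neighbour
  ...   | true  = ⊥-elim (neighbours-separate G W v u≢v
                   (connected X (subst (_< k) (sym (∣tabulate∣ (neighboursIn W v))) (ℕP.≰⇒> k≰deg)) v u Wv Wu X∌v X∌u))
    where
    X : Subset n
    X = tabulate (neighboursIn W v)
    found : Σ (Fin n) λ u → W u ∧ (not (adj G v u) ∧ not (u ≟ᵇ v)) ≡ true
    found = anyᵇ-elim _ non-neighbour
    u : Fin n
    u = proj₁ found
    Wu : W u ≡ true
    Wu = ∧-elimˡ (W u) (proj₂ found)
    v≁u : adj G v u ≡ false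
    v≁u = not-true (∧-elimˡ (not (adj G v u)) (∧-elimʳ (W u) (proj₂ found)))
    u≢v : u ≟ᵇ v ≡ false
    u≢v = not-true (∧-elimʳ (not (adj G v u)) (∧-elimʳ (W u) (proj₂ found)))
    X∌v : lookup X v ≡ false
    X∌v = trans (VecP.lookup∘tabulate (neighboursIn W v) v) (cong (_∧ W v) (irrefl G v))
    X∌u : lookup X u ≡ false
    X∌u = trans (VecP.lookup∘tabulate (neighboursIn W v) u) (cong (_∧ W u) v≁u)
  -- otherwise v is adjacent to all of the maximum clique Q
  ...   | false = contradiction (card-clique-≤ maximum (insert v Q) (insert-clique Q v Q-clique v~Q))
                                (ℕP.<⇒≱ (ℕP.≤-reflexive (trans (cong suc (sym card-Q)) (sym (card-insert Q v Qv)))))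
    where
    v~Q : ∀ x → Q x ≡ true → Adj G v x
    v~Q x Qx with true-or-false (adj G v x)
    ... | inj₁ v~x = v~x
    ... | inj₂ v≁x =
      contradiction (anyᵇ-intro _ x (∧-intro (Q⊆W x Qx) (∧-intro (not-false v≁x) (not-false (≟ᵇ-≢ x≢v)))))
                                   (λ p → true≢false p non-neighbour)
      where x≢v : x ≢ v
            x≢v refl = true≢false Qx Qv

  -- ms: the degrees of the vertices outside Q, each simplicial when it is removed
  Dismantling : VSet n → Set
  Dismantling W = Σ (List ℕ) λ ms → All (λ m → k ≤ m × m < d) ms ×
    (∀ j → cliquesIn W (suc j) ≡ binomialSum ms j + d C suc j) × (k ≤ d ⊎ card W ≤ d)

  dismantle : ∀ W → (∀ x → Q x ≡ true → W x ≡ true) → KConnectedIn k G W → Dismantling W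
  dismantle W = by-size (card W) W refl
    where
    Claim : ℕ → Set
    Claim s = ∀ W → card W ≡ s → (∀ x → Q x ≡ true → W x ≡ true) → KConnectedIn k G W → Dismantling W
    by-size : ∀ s → Claim s
    by-size = <-rec Claim remove-one
      where
      remove-one : ∀ s → (∀ {s′} → s′ < s → Claim s′) → Claim s
      remove-one s IH W card≡s Q⊆W connected with true-or-false (anyᵇ (λ w → W w ∧ not (Q w)))
      ... | inj₂ W⊆Q = [] , [] ,
            (λ j → trans (cliquesIn-cong W Q W≗Q (suc j))
                         (trans (cliquesIn-clique Q Q-clique (suc j)) (cong (_C suc j) card-Q))) ,
            inj₂ (subst (card W ≤_) card-Q (card-mono W Q (λ x Wx → trans (sym (W≗Q x)) Wx)))
        where
        W≗Q : ∀ x → W x ≡ Q x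
        W≗Q x with W x in Wx | Q x in Qx
        ... | true  | true  = refl
        ... | false | false = refl
        ... | false | true  = contradiction (Q⊆W x Qx) (λ Wx′ → true≢false Wx′ Wx)
        ... | true  | false = contradiction (anyᵇ-false _ W⊆Q x) (λ none → true≢false (∧-intro Wx (not-false Qx)) none)
      ... | inj₁ W⊈Q with anyᵇ-elim _ W⊈Q
      ...   | (w , Ww∖Q) with simplicial-outside-clique W Q w Q-clique (∧-elimˡ (W w) Ww∖Q) (not-true (∧-elimʳ (W w) Ww∖Q))
      ...     | (v , Wv , Qv , simplicial) with IH smaller (remove v W) refl Q⊆W-v (KConnectedIn-remove k G W v simplicial connected)
        where
        smaller : card (remove v W) < s
        smaller = subst (card (remove v W) <_) card≡s (card-strict (remove v W) W (λ x → ∧-elimˡ (W x)) v Wv (remove-self v W))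
        Q⊆W-v : ∀ x → Q x ≡ true → remove v W x ≡ true
        Q⊆W-v x Qx = ∧-intro (Q⊆W x Qx) (not-false (≟ᵇ-≢ {x = x} {v} λ { refl → true≢false Qx Qv }))
      ...       | (ms , bounds , counts , _) =
        deg ∷ ms , (degree-≥ W v Wv Qv Q⊆W connected , degree-< W v simplicial) ∷ bounds ,
        (λ j → trans (cliquesIn-simplicial W v Wv simplicial j)
                     (trans (cong (_+ deg C j) (counts j)) (trans (ℕP.+-comm _ (deg C j)) (sym (ℕP.+-assoc (deg C j) _ _))))) ,
        inj₁ (ℕP.≤-trans (degree-≥ W v Wv Qv Q⊆W connected) (ℕP.<⇒≤ (degree-< W v simplicial)))
        where
        deg : ℕ
        deg = card (neighboursIn W v)

binomialSum-++ : ∀ ms ms′ j → binomialSum (ms ++ ms′) j ≡ binomialSum ms j + binomialSum ms′ j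
binomialSum-++ []       ms′ j = refl
binomialSum-++ (m ∷ ms) ms′ j = trans (cong (λ s → m C j + s) (binomialSum-++ ms ms′ j)) (sym (ℕP.+-assoc (m C j) _ _))

binomialSum-downFrom : ∀ d j → binomialSum (downFrom d) j ≡ d C suc j
binomialSum-downFrom zero    j = refl
binomialSum-downFrom (suc d) j = trans (cong (λ s → d C j + s) (binomialSum-downFrom d j)) (nCk+nC[k+1]≡[n+1]C[k+1] d j)

binomialSum-above : ∀ d ms → All (_< d) ms → ∀ j → d ≤ j → binomialSum ms j ≡ 0
binomialSum-above d []       []           j d≤j = refl
binomialSum-above d (m ∷ ms) (m<d ∷ ms<d) j d≤j =
  cong₂ _+_ (k>n⇒nCk≡0 (ℕP.<-≤-trans m<d d≤j)) (binomialSum-above d ms ms<d j d≤j)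

occurrences-++ : ∀ i ms ms′ → occurrences i (ms ++ ms′) ≡ occurrences i ms + occurrences i ms′
occurrences-++ i []       ms′ = refl
occurrences-++ i (m ∷ ms) ms′ = trans (cong (λ s → δ m i + s) (occurrences-++ i ms ms′)) (sym (ℕP.+-assoc (δ m i) _ _))

occurrences-≤-binomialSum : ∀ i ms → occurrences i ms ≤ binomialSum ms i
occurrences-≤-binomialSum i []       = z≤n
occurrences-≤-binomialSum i (m ∷ ms) = ℕP.+-mono-≤ (δ≤C m i) (occurrences-≤-binomialSum i ms)
  where δ≤C : ∀ m i → δ m i ≤ m C i
        δ≤C m i with m Nat.≟ i
        ... | yes refl = ℕP.≤-reflexive (trans (δ-diag m) (sym (nCn≡1 m)))
        ... | no  m≢i  = subst (_≤ m C i) (sym (δ-≢ m≢i)) z≤n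

occurrences-absent : ∀ i ms → All (_≢ i) ms → occurrences i ms ≡ 0
occurrences-absent i []       []            = refl
occurrences-absent i (m ∷ ms) (m≢i ∷ ms≢i) = cong₂ _+_ (δ-≢ m≢i) (occurrences-absent i ms ms≢i)

occurrences-downFrom : ∀ i d → i < d → occurrences i (downFrom d) ≡ 1
occurrences-downFrom i (suc d) i<1+d with ℕP.m≤n⇒m<n∨m≡n (ℕP.≤-pred i<1+d)
... | inj₁ i<d  = trans (cong (_+ occurrences i (downFrom d)) (δ-≢ (ℕP.>⇒≢ i<d))) (occurrences-downFrom i d i<d)
... | inj₂ refl = cong₂ _+_ (δ-diag i)
                    (occurrences-absent i (downFrom i) (AllP.applyDownFrom⁺₁ (λ m → m) i ℕP.<⇒≢))

occurrences-replicate : ∀ c m → occurrences m (replicate c m) ≡ c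
occurrences-replicate zero    m = refl
occurrences-replicate (suc c) m = cong₂ _+_ (δ-diag m) (occurrences-replicate c m)

All-<-downFrom : ∀ d → All (_< d) (downFrom d)
All-<-downFrom d = AllP.applyDownFrom⁺₁ (λ m → m) d (λ m<d → m<d)

entry-lookup : ∀ {d} (c : Vec ℕ d) (j : Fin d) → entry c (toℕ j) ≡ lookup c j
entry-lookup (x ∷ c) zero    = refl
entry-lookup (x ∷ c) (suc j) = entry-lookup c j

KConnected⇒KConnectedIn : ∀ k {n} (G : Graph n) → KConnected k G → KConnectedIn k G (λ _ → true)
KConnected⇒KConnectedIn k G (_ , connected) X ∣X∣<k u w _ _ X∌u X∌w =
  reach⇒walk (connected X ∣X∣<k u w (λ u∈X → true≢false (∈⇒lookup u∈X) X∌u)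
                                    (λ w∈X → true≢false (∈⇒lookup w∈X) X∌w))
  where
  reach⇒walk : ∀ {u w} → Reach G X u w → Walks.Walk G (avoiding (λ _ → true) X) u w
  reach⇒walk (Defs.here u∉X)        = Walks.here (not-false (∉⇒lookup u∉X))
  reach⇒walk (Defs.step u∉X u~v rest) = Walks.step (not-false (∉⇒lookup u∉X)) u~v (reach⇒walk rest)

clique-vector-degrees : ∀ k d {n} (G : Graph n) (c : Vec ℕ d) → Chordal G → KConnected k G → IsCliqueVector G d c →
  Σ (List ℕ) λ ms → All (λ m → k ≤ m × m < d) ms × k ≤ d ×
    (∀ j → j < d → entry c j ≡ binomialSum (ms ++ downFrom d) j)
clique-vector-degrees k d {n} G c chordal connected ((S , S-clique , ∣S∣≡d) , maximum , c≡)
  with Elimination.dismantle G chordal k d maximum (lookup S)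
         (λ x y x∈S y∈S → S-clique x y (lookup⇒∈ x∈S) (lookup⇒∈ y∈S)) (trans (card-lookup S) ∣S∣≡d)
         (λ _ → true) (λ _ _ → refl) (KConnected⇒KConnectedIn k G connected)
... | (ms , bounds , counts , k≤d∨n≤d) = ms , bounds , k≤d , c≡binomialSum
  where
  open Cliques G
  k≤d : k ≤ d
  k≤d = case k≤d∨n≤d of λ where
    (inj₁ k≤d) → k≤d
    (inj₂ n≤d) → ℕP.≤-trans (proj₁ connected) (subst (_≤ d) (card-all n) n≤d)
  c≡binomialSum : ∀ j → j < d → entry c j ≡ binomialSum (ms ++ downFrom d) j
  c≡binomialSum j j<d = begin
    entry c j                                          ≡⟨ cong (entry c) (FinP.toℕ-fromℕ< j<d) ⟨
    entry c (toℕ (fromℕ< j<d))                         ≡⟨ entry-lookup c (fromℕ< j<d) ⟩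
    lookup c (fromℕ< j<d)                              ≡⟨ c≡ (fromℕ< j<d) ⟩
    numCliques G (suc (toℕ (fromℕ< j<d)))              ≡⟨ cong (numCliques G ∘ suc) (FinP.toℕ-fromℕ< j<d) ⟩
    numCliques G (suc j)                               ≡⟨ numCliques≡cliquesIn (suc j) ⟩
    cliquesIn (λ _ → true) (suc j)                     ≡⟨ counts j ⟩
    binomialSum ms j + d C suc j                       ≡⟨ cong (λ s → binomialSum ms j + s) (binomialSum-downFrom d j) ⟨
    binomialSum ms j + binomialSum (downFrom d) j      ≡⟨ binomialSum-++ ms (downFrom d) j ⟨
    binomialSum (ms ++ downFrom d) j                   ∎
    where open ≡-Reasoning

module SplitGraph {n} (G : Graph n) (K : VSet n) (K-clique : Cliques.IsCliqueᵛ G K)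
  (edge-meets-K : ∀ u w → Adj G u w → K w ≡ false → K u ≡ true) where
  open Cliques G

  chordal : Chordal G
  chordal (suc (suc (suc (suc m′)))) (s≤s (s≤s (s≤s (s≤s _)))) v (v-injective , v-edge) =
    case true-or-false (K (v p₁)) of λ where
      (inj₂ v₁∉K) → chord p₀ p₂ (λ ()) (λ { (inj₁ ()) ; (inj₂ (() , _)) }) (λ { (inj₁ ()) ; (inj₂ (() , _)) })
                      (edge-meets-K (v p₀) (v p₁) (v-edge p₀ p₁ (inj₁ refl)) v₁∉K)
                      (edge-meets-K (v p₂) (v p₁) (Adj-sym G (v-edge p₁ p₂ (inj₁ refl))) v₁∉K)
      (inj₁ v₁∈K) → case true-or-false (K (v p₃)) of λ where
        (inj₁ v₃∈K) → chord p₁ p₃ (λ ()) (λ { (inj₁ ()) ; (inj₂ (() , _)) }) (λ { (inj₁ ()) ; (inj₂ (_ , ())) })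
                        v₁∈K v₃∈K
        (inj₂ v₃∉K) → around-v₃ m′ refl v₃∉K
    where
    M : ℕ
    M = suc (suc (suc (suc m′)))
    p₀ p₁ p₂ p₃ : Fin M
    p₀ = zero
    p₁ = suc zero
    p₂ = suc (suc zero)
    p₃ = suc (suc (suc zero))
    chord : ∀ p q → p ≢ q → ¬ CycNext M p q → ¬ CycNext M q p → K (v p) ≡ true → K (v q) ≡ true → HasChord G M v
    chord p q p≢q ¬p→q ¬q→p Kp Kq = p , q , p≢q , ¬p→q , ¬q→p , K-clique (v p) (v q) Kp Kq (p≢q ∘ v-injective)
    -- both cycle neighbours of v₃ lie in K
    around-v₃ : ∀ m″ → m″ ≡ m′ → K (v p₃) ≡ false → HasChord G M v
    around-v₃ zero refl v₃∉K =
      chord p₂ p₀ (λ ()) (λ { (inj₁ ()) ; (inj₂ (() , _)) }) (λ { (inj₁ ()) ; (inj₂ (() , _)) })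
      (edge-meets-K (v p₂) (v p₃) (v-edge p₂ p₃ (inj₁ refl)) v₃∉K)
      (edge-meets-K (v p₀) (v p₃) (Adj-sym G (v-edge p₃ p₀ (inj₂ (refl , refl)))) v₃∉K)
    around-v₃ (suc m₀) refl v₃∉K =
      chord p₂ p₄ (λ ()) (λ { (inj₁ ()) ; (inj₂ (() , _)) }) (λ { (inj₁ ()) ; (inj₂ (_ , ())) })
      (edge-meets-K (v p₂) (v p₃) (v-edge p₂ p₃ (inj₁ refl)) v₃∉K)
      (edge-meets-K (v p₄) (v p₃) (Adj-sym G (v-edge p₃ p₄ (inj₁ refl))) v₃∉K)
      where p₄ : Fin M
            p₄ = suc (suc (suc (suc zero)))

  k-connected : ∀ k → k ≤ n → (∀ u → K u ≡ false → k ≤ card (neighboursIn K u)) → KConnected k G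
  k-connected k k≤n K-degree = k≤n , connected
    where
    -- fewer than k deleted vertices cannot cover the ≥ k neighbours in K of a vertex outside K
    anchor : ∀ X → ∣ X ∣ < k → ∀ u → u ∉ X → Σ (Fin n) λ c → c ∉ X × K c ≡ true × (c ≡ u ⊎ Adj G u c)
    anchor X ∣X∣<k u u∉X with true-or-false (K u)
    ... | inj₁ Ku  = u , u∉X , Ku , inj₁ refl
    ... | inj₂ u∉K with true-or-false (anyᵇ (λ c → neighboursIn K u c ∧ not (lookup X c)))
    ...   | inj₁ some with anyᵇ-elim _ some
    ...     | (c , Nc∖X) = c , (λ c∈X → true≢false (∈⇒lookup c∈X) (not-true (∧-elimʳ (neighboursIn K u c) Nc∖X))) ,
                           ∧-elimʳ (adj G u c) Nc , inj₂ (∧-elimˡ (adj G u c) Nc)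
      where Nc : neighboursIn K u c ≡ true
            Nc = ∧-elimˡ (neighboursIn K u c) Nc∖X
    anchor X ∣X∣<k u u∉X | inj₂ u∉K | inj₂ none =
      contradiction (ℕP.≤-trans (K-degree u u∉K) N≤∣X∣) (ℕP.<⇒≱ ∣X∣<k)
      where
      N⊆X : ∀ c → neighboursIn K u c ≡ true → lookup X c ≡ true
      N⊆X c Nc with lookup X c in Xc
      ... | true  = refl
      ... | false = contradiction (anyᵇ-intro _ c (∧-intro Nc (not-false Xc))) (λ p → true≢false p none)
      N≤∣X∣ : card (neighboursIn K u) ≤ ∣ X ∣
      N≤∣X∣ = subst (_ ≤_) (card-lookup X) (card-mono _ (lookup X) N⊆X)

    connected : ∀ X → ∣ X ∣ < k → ConnectedWithout G X
    connected X ∣X∣<k u w u∉X w∉X with anchor X ∣X∣<k u u∉X | anchor X ∣X∣<k w w∉X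
    ... | (cu , cu∉X , Kcu , u→cu) | (cw , cw∉X , Kcw , w→cw) = from-u u→cu (across (to-w w→cw))
      where
      to-w : cw ≡ w ⊎ Adj G w cw → Reach G X cw w
      to-w (inj₁ refl) = Defs.here cw∉X
      to-w (inj₂ w~cw) = Defs.step cw∉X (Adj-sym G w~cw) (Defs.here w∉X)
      across : Reach G X cw w → Reach G X cu w
      across cw→w with cu Fin.≟ cw
      ... | yes refl  = cw→w
      ... | no  cu≢cw = Defs.step cu∉X (K-clique cu cw Kcu Kcw cu≢cw) cw→w
      from-u : cu ≡ u ⊎ Adj G u cu → Reach G X cu w → Reach G X u w
      from-u (inj₁ refl) cu→w = cu→w
      from-u (inj₂ u~cu) cu→w = Defs.step u∉X u~cu cu→w

at : List ℕ → ℕ → ℕ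
at []       t       = 0
at (x ∷ xs) zero    = x
at (x ∷ xs) (suc t) = at xs t

All-at : ∀ {P : ℕ → Set} {xs} → All P xs → ∀ t → t < length xs → P (at xs t)
All-at (p ∷ _)  zero    _         = p
All-at (_ ∷ ps) (suc t) (s≤s t<l) = All-at ps t t<l

sumBelow : ℕ → (ℕ → ℕ) → ℕ
sumBelow zero    f = 0
sumBelow (suc t) f = f t + sumBelow t f

sumBelow-suc : ∀ t f → sumBelow (suc t) f ≡ f 0 + sumBelow t (f ∘ suc)
sumBelow-suc zero    f = refl
sumBelow-suc (suc t) f = begin
  f (suc t) + sumBelow (suc t) f          ≡⟨ cong (λ s → f (suc t) + s) (sumBelow-suc t f) ⟩
  f (suc t) + (f 0 + sumBelow t (f ∘ suc)) ≡⟨ ℕP.+-assoc (f (suc t)) (f 0) _ ⟨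
  f (suc t) + f 0 + sumBelow t (f ∘ suc)   ≡⟨ cong (_+ sumBelow t (f ∘ suc)) (ℕP.+-comm (f (suc t)) (f 0)) ⟩
  f 0 + f (suc t) + sumBelow t (f ∘ suc)   ≡⟨ ℕP.+-assoc (f 0) (f (suc t)) _ ⟩
  f 0 + sumBelow (suc t) (f ∘ suc)         ∎
  where open ≡-Reasoning

occurrences-at : ∀ i xs → sumBelow (length xs) (λ s → δ (at xs s) i) ≡ occurrences i xs
occurrences-at i []       = refl
occurrences-at i (x ∷ xs) =
  trans (sumBelow-suc (length xs) (λ s → δ (at (x ∷ xs) s) i)) (cong (λ s → δ x i + s) (occurrences-at i xs))

-- vertices 0, …, d - 1 form a clique; vertex d + t is joined to the first  at ext t  of them
module Construction (d : ℕ) (1≤d : 1 ≤ d) (ext : List ℕ) (ext<d : All (_< d) ext) where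
  N : ℕ
  N = d + length ext

  attach : ℕ → ℕ
  attach y = if y <ᵇ d then y else at ext (y ∸ d)

  attach-< : ∀ y → y < d → attach y ≡ y
  attach-< y y<d rewrite <ᵇ-true y<d = refl

  attach-≥ : ∀ y → d ≤ y → attach y ≡ at ext (y ∸ d)
  attach-≥ y d≤y rewrite <ᵇ-false d≤y = refl

  attach<d : ∀ y → attach y < d
  attach<d y with y <ᵇ d in y<ᵇd
  ... | true  = <ᵇ-true⇒ y<ᵇd
  ... | false with (y ∸ d) Nat.<? length ext
  ...   | yes t<l = All-at ext<d (y ∸ d) t<l
  ...   | no  t≮l = subst (_< d) (sym (at-beyond ext (y ∸ d) (ℕP.≮⇒≥ t≮l))) 1≤d
    where at-beyond : ∀ xs t → length xs ≤ t → at xs t ≡ 0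
          at-beyond []       t       _         = refl
          at-beyond (x ∷ xs) (suc t) (s≤s l≤t) = at-beyond xs t l≤t

  attach≤ : ∀ y → attach y ≤ y
  attach≤ y with y Nat.<? d
  ... | yes y<d = ℕP.≤-reflexive (attach-< y y<d)
  ... | no  y≮d = ℕP.<⇒≤ (ℕP.<-≤-trans (attach<d y) (ℕP.≮⇒≥ y≮d))

  attach≤N : ∀ y → attach y ≤ N
  attach≤N y = ℕP.≤-trans (ℕP.<⇒≤ (attach<d y)) (ℕP.m≤m+n d (length ext))

  below : ℕ → ℕ → Bool
  below x y = x <ᵇ attach y

  below⇒< : ∀ x y → below x y ≡ true → x < y
  below⇒< x y x<y = ℕP.<-≤-trans (<ᵇ-true⇒ x<y) (attach≤ y)

  linked : ℕ → ℕ → Bool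
  linked x y = below x y ∨ below y x

  G : Graph N
  G = record
    { adj    = λ u v → linked (toℕ u) (toℕ v)
    ; sym    = λ u v → BoolP.∨-comm (below (toℕ u) (toℕ v)) (below (toℕ v) (toℕ u))
    ; irrefl = λ v → cong (λ b → b ∨ b) (below-irrefl (toℕ v))
    }
    where below-irrefl : ∀ x → below x x ≡ false
          below-irrefl x with below x x in x<x
          ... | false = refl
          ... | true  = contradiction (below⇒< x x x<x) (ℕP.<-irrefl refl)

  open Cliques G

  initial : ℕ → VSet N
  initial t x = toℕ x <ᵇ t

  K : VSet N
  K = initial d

  K-clique : IsCliqueᵛ K
  K-clique x y Kx Ky x≢y with ℕP.<-cmp (toℕ x) (toℕ y)
  ... | tri< x<y _ _ = ∨-introˡ _ (<ᵇ-true (subst (toℕ x <_) (sym (attach-< (toℕ y) (<ᵇ-true⇒ Ky))) x<y))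
  ... | tri≈ _ x≡y _ = contradiction (FinP.toℕ-injective x≡y) x≢y
  ... | tri> _ _ y<x =
    ∨-introʳ (below (toℕ x) (toℕ y)) (<ᵇ-true (subst (toℕ y <_) (sym (attach-< (toℕ x) (<ᵇ-true⇒ Kx))) y<x))

  linked-below-d : ∀ x y → linked x y ≡ true → d ≤ y → x < d
  linked-below-d x y x~y d≤y with ∨-elim (below x y) x~y
  ... | inj₁ x<y = ℕP.<-trans (<ᵇ-true⇒ x<y) (attach<d y)
  ... | inj₂ y<x = contradiction (ℕP.<-≤-trans (ℕP.<-trans (<ᵇ-true⇒ y<x) (attach<d x)) d≤y) (ℕP.<-irrefl refl)

  edge-meets-K : ∀ u w → Adj G u w → K w ≡ false → K u ≡ true
  edge-meets-K u w u~w Kw =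
    <ᵇ-true (linked-below-d (toℕ u) (toℕ w) u~w (ℕP.≮⇒≥ (λ w<d → true≢false (<ᵇ-true w<d) Kw)))

  chordal : Chordal G
  chordal = SplitGraph.chordal G K K-clique edge-meets-K

  k-connected : ∀ k → k ≤ d → All (k ≤_) ext → KConnected k G
  k-connected k k≤d k≤ext = SplitGraph.k-connected G K K-clique edge-meets-K k (ℕP.≤-trans k≤d (ℕP.m≤m+n d _)) degree
    where
    degree : ∀ u → K u ≡ false → k ≤ card (neighboursIn K u)
    degree u u∉K = begin
      k                             ≤⟨ subst (k ≤_) (sym (attach-≥ (toℕ u) d≤u)) (All-at k≤ext (toℕ u ∸ d) index) ⟩
      attach (toℕ u)                ≡⟨ card-initial N (attach (toℕ u)) (attach≤N (toℕ u)) ⟨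
      card (initial (attach (toℕ u))) ≤⟨ card-mono _ _ below⇒neighbour ⟩
      card (neighboursIn K u)       ∎
      where
      open ℕP.≤-Reasoning
      d≤u : d ≤ toℕ u
      d≤u = ℕP.≮⇒≥ (λ u<d → true≢false (<ᵇ-true u<d) u∉K)
      index : toℕ u ∸ d < length ext
      index = ℕP.+-cancelˡ-< d _ _ (subst (_< N) (sym (ℕP.m+[n∸m]≡n d≤u)) (FinP.toℕ<n u))
      below⇒neighbour : ∀ x → initial (attach (toℕ u)) x ≡ true → neighboursIn K u x ≡ true
      below⇒neighbour x x<a = ∧-intro (∨-introʳ (below (toℕ u) (toℕ x)) x<a)
                                      (<ᵇ-true (ℕP.<-trans (<ᵇ-true⇒ x<a) (attach<d (toℕ u))))

  -- vertex t is simplicial in the subgraph on 0, …, t, with neighbours 0, …, attach t - 1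
  cliquesIn-initial-suc : ∀ t → t < N → ∀ j →
    cliquesIn (initial (suc t)) (suc j) ≡ cliquesIn (initial t) (suc j) + attach t C j
  cliquesIn-initial-suc t t<N j =
    trans (cliquesIn-simplicial (initial (suc t)) v (<ᵇ-true (subst (_< suc t) (sym toℕv) ℕP.≤-refl)) simplicial j)
          (cong₂ _+_ (cliquesIn-cong _ _ remove-v (suc j))
                     (cong (_C j) (trans (card-cong _ _ neighbours-v)
                                         (card-initial N (attach t) (attach≤N t)))))
    where
    v : Fin N
    v = fromℕ< t<N
    toℕv : toℕ v ≡ t
    toℕv = FinP.toℕ-fromℕ< t<N
    neighbours-v : ∀ x → neighboursIn (initial (suc t)) v x ≡ initial (attach t) x
    neighbours-v x = ≡-from-⇔ to from
      where
      to : neighboursIn (initial (suc t)) v x ≡ true → initial (attach t) x ≡ true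
      to v~x∧x≤t with ∨-elim (below (toℕ v) (toℕ x)) (∧-elimˡ (linked (toℕ v) (toℕ x)) v~x∧x≤t)
      ... | inj₁ v<x = contradiction (subst (_< toℕ x) toℕv (below⇒< _ _ v<x))
                         (ℕP.≤⇒≯ (ℕP.≤-pred (<ᵇ-true⇒ (∧-elimʳ (linked (toℕ v) (toℕ x)) v~x∧x≤t))))
      ... | inj₂ x<v = subst (λ z → (toℕ x <ᵇ attach z) ≡ true) toℕv x<v
      from : initial (attach t) x ≡ true → neighboursIn (initial (suc t)) v x ≡ true
      from x<a = ∧-intro (∨-introʳ (below (toℕ v) (toℕ x)) (subst (λ z → (toℕ x <ᵇ attach z) ≡ true) (sym toℕv) x<a))
                         (<ᵇ-true (ℕP.<-≤-trans (<ᵇ-true⇒ x<a) (ℕP.≤-trans (attach≤ t) (ℕP.n≤1+n t))))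
    remove-v : ∀ x → remove v (initial (suc t)) x ≡ initial t x
    remove-v x = ≡-from-⇔ to from
      where
      to : remove v (initial (suc t)) x ≡ true → initial t x ≡ true
      to p = <ᵇ-true (ℕP.≤∧≢⇒< (ℕP.≤-pred (<ᵇ-true⇒ (∧-elimˡ (initial (suc t) x) p)))
               (λ x≡t → true≢false (≟ᵇ-refl v) (subst (λ z → z ≟ᵇ v ≡ false)
                          (FinP.toℕ-injective (trans x≡t (sym toℕv))) (not-true (∧-elimʳ (initial (suc t) x) p)))))
      from : initial t x ≡ true → remove v (initial (suc t)) x ≡ true
      from x<t = ∧-intro (<ᵇ-true (ℕP.m<n⇒m<1+n (<ᵇ-true⇒ {toℕ x} {t} x<t)))
                         (not-false (≟ᵇ-≢ {x = x} {v} (λ x≡v →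
                           ℕP.<-irrefl (trans (cong toℕ x≡v) toℕv) (<ᵇ-true⇒ {toℕ x} {t} x<t))))
    simplicial : Simplicial (initial (suc t)) v
    simplicial x y x≤t y≤t v~x v~y x≢y =
      K-clique x y (in-K x (∧-intro v~x x≤t)) (in-K y (∧-intro v~y y≤t)) x≢y
      where in-K : ∀ z → neighboursIn (initial (suc t)) v z ≡ true → K z ≡ true
            in-K z N-z = <ᵇ-true (ℕP.<-trans (<ᵇ-true⇒ (trans (sym (neighbours-v z)) N-z)) (attach<d t))

  attachments : ℕ → List ℕ
  attachments t = map attach (downFrom t)

  cliquesIn-initial : ∀ t → t ≤ N → ∀ j → cliquesIn (initial t) (suc j) ≡ binomialSum (attachments t) j
  cliquesIn-initial zero    _     j = cliquesIn-∅ j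
  cliquesIn-initial (suc t) t<N j = begin
    cliquesIn (initial (suc t)) (suc j)                 ≡⟨ cliquesIn-initial-suc t t<N j ⟩
    cliquesIn (initial t) (suc j) + attach t C j        ≡⟨ cong (_+ attach t C j) (cliquesIn-initial t (ℕP.<⇒≤ t<N) j) ⟩
    binomialSum (attachments t) j + attach t C j        ≡⟨ ℕP.+-comm _ (attach t C j) ⟩
    binomialSum (attachments (suc t)) j                 ∎
    where open ≡-Reasoning

  numCliques-G : ∀ j → numCliques G (suc j) ≡ binomialSum (attachments N) j
  numCliques-G j = trans (numCliques≡cliquesIn (suc j))
    (trans (cliquesIn-cong _ (initial N) (λ x → sym (<ᵇ-true (FinP.toℕ<n x))) (suc j)) (cliquesIn-initial N ℕP.≤-refl j))

  attachments<d : All (_< d) (attachments N)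
  attachments<d = AllP.map⁺ (AllP.applyDownFrom⁺₂ (λ m → m) N attach<d)

  occurrences-attachments : ∀ i → occurrences i (attachments N) ≡ occurrences i ext + occurrences i (downFrom d)
  occurrences-attachments i = trans (extras (length ext)) (cong (_+ occurrences i (downFrom d)) (occurrences-at i ext))
    where
    clique-part : ∀ t → t ≤ d → attachments t ≡ downFrom t
    clique-part zero    _   = refl
    clique-part (suc t) t<d = cong₂ _∷_ (attach-< t t<d) (clique-part t (ℕP.<⇒≤ t<d))
    extras : ∀ t → occurrences i (attachments (d + t)) ≡ sumBelow t (λ s → δ (at ext s) i) + occurrences i (downFrom d)
    extras zero    = cong (occurrences i) (trans (cong attachments (ℕP.+-identityʳ d)) (clique-part d ℕP.≤-refl))
    extras (suc t) = begin
      occurrences i (attachments (d + suc t))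
        ≡⟨ cong (occurrences i ∘ attachments) (ℕP.+-suc d t) ⟩
      δ (attach (d + t)) i + occurrences i (attachments (d + t))
        ≡⟨ cong₂ (λ a o → δ a i + o) (trans (attach-≥ (d + t) (ℕP.m≤m+n d t)) (cong (at ext) (ℕP.m+n∸m≡n d t))) (extras t) ⟩
      δ (at ext t) i + (sumBelow t (λ s → δ (at ext s) i) + occurrences i (downFrom d))
        ≡⟨ ℕP.+-assoc (δ (at ext t) i) _ _ ⟨
      sumBelow (suc t) (λ s → δ (at ext s) i) + occurrences i (downFrom d) ∎
      where open ≡-Reasoning

numCliques-pos⇒clique : ∀ {n} (G : Graph n) j → 0 < numCliques G j → Σ (Subset n) λ S → IsClique G S × ∣ S ∣ ≡ j
numCliques-pos⇒clique {n} G j pos =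
  let (S , _ , S-ok) = count-pos⇒∃ _ (allSubsets n)
                         (subst (0 <_) (length-filter (λ S → isClique? G S ×-dec (∣ S ∣ Nat.≟ j)) (allSubsets n)) pos)
  in S , does-true⇒ (isClique? G S ×-dec (∣ S ∣ Nat.≟ j)) S-ok

clique⇒numCliques-pos : ∀ {n} (G : Graph n) S → IsClique G S → 0 < numCliques G ∣ S ∣
clique⇒numCliques-pos {n} G S S-clique =
  subst (0 <_) (sym (length-filter (λ T → isClique? G T ×-dec (∣ T ∣ Nat.≟ ∣ S ∣)) (allSubsets n)))
    (∈⇒count-pos _ (allSubsets n) (allSubsets-complete S)
      (dec-true (isClique? G S ×-dec (∣ S ∣ Nat.≟ ∣ S ∣)) (S-clique , refl)))

positive-form : ∀ z → + 0 <ℤ z → z ≡ + suc (Int.∣ z ∣ ∸ 1)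
positive-form (+ suc m) _         = refl
positive-form (+ zero)  (+<+ ())

module Realisation (k d : ℕ) (1≤d : 1 ≤ d) (c : Vec ℕ d)
  (positive : ∀ i → i < d → + 0 <ℤ coeff (bPoly c) i) (ones : ∀ i → i < k → coeff (bPoly c) i ≡ + 1) where

  k≤d : k ≤ d
  k≤d with k Nat.≤? d
  ... | yes k≤d = k≤d
  ... | no  k≰d = contradiction (trans (sym (ones d (ℕP.≰⇒> k≰d))) (coeff-bPoly-above c d ℕP.≤-refl)) λ ()

  -- β i = b_(i+1) - 1, the number of extra vertices joined to i clique vertices
  β : ℕ → ℕ
  β i = Int.∣ coeff (bPoly c) i ∣ ∸ 1

  β-below-k : ∀ i → i < k → β i ≡ 0
  β-below-k i i<k = cong (λ z → Int.∣ z ∣ ∸ 1) (ones i i<k)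

  extras : ℕ → List ℕ
  extras zero    = []
  extras (suc i) = replicate (β i) i ++ extras i

  extras-bounds : ∀ t → t ≤ d → All (λ m → k ≤ m × m < d) (extras t)
  extras-bounds zero    _   = []
  extras-bounds (suc i) i<d = AllP.++⁺ copies (extras-bounds i (ℕP.<⇒≤ i<d))
    where
    copies : All (λ m → k ≤ m × m < d) (replicate (β i) i)
    copies with i Nat.<? k
    ... | yes i<k = subst (λ b → All (λ m → k ≤ m × m < d) (replicate b i)) (sym (β-below-k i i<k)) []
    ... | no  i≮k = AllP.replicate⁺ (β i) (ℕP.≮⇒≥ i≮k , i<d)

  occurrences-extras-≥ : ∀ i t → t ≤ i → occurrences i (extras t) ≡ 0
  occurrences-extras-≥ i zero    _   = refl
  occurrences-extras-≥ i (suc t) t<i = trans (occurrences-++ i (replicate (β t) t) (extras t))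
    (cong₂ _+_ (occurrences-absent i _ (AllP.replicate⁺ (β t) (ℕP.<⇒≢ t<i))) (occurrences-extras-≥ i t (ℕP.<⇒≤ t<i)))

  occurrences-extras-< : ∀ i t → i < t → occurrences i (extras t) ≡ β i
  occurrences-extras-< i (suc t) i<1+t with ℕP.m≤n⇒m<n∨m≡n (ℕP.≤-pred i<1+t)
  ... | inj₁ i<t  = trans (occurrences-++ i (replicate (β t) t) (extras t))
    (cong₂ _+_ (occurrences-absent i _ (AllP.replicate⁺ (β t) (ℕP.>⇒≢ i<t))) (occurrences-extras-< i t i<t))
  ... | inj₂ refl = trans (occurrences-++ i (replicate (β i) i) (extras i))
    (trans (cong₂ _+_ (occurrences-replicate (β i) i) (occurrences-extras-≥ i i ℕP.≤-refl)) (ℕP.+-identityʳ (β i)))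

  bounds : All (λ m → k ≤ m × m < d) (extras d)
  bounds = extras-bounds d ℕP.≤-refl

  open Construction d 1≤d (extras d) (All.map proj₂ bounds)

  coeff≡occurrences : ∀ i → i < d → coeff (bPoly c) i ≡ + occurrences i (attachments N)
  coeff≡occurrences i i<d = begin
    coeff (bPoly c) i                                             ≡⟨ positive-form _ (positive i i<d) ⟩
    + suc (β i)                                                   ≡⟨ cong +_ (ℕP.+-comm 1 (β i)) ⟩
    + (β i + 1)                                                   ≡⟨ cong +_ (cong₂ _+_ β≡ (sym (occurrences-downFrom i d i<d))) ⟩
    + (occurrences i (extras d) + occurrences i (downFrom d))     ≡⟨ cong +_ (occurrences-attachments i) ⟨
    + occurrences i (attachments N)                               ∎
    where
    open ≡-Reasoning
    β≡ : β i ≡ occurrences i (extras d)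
    β≡ = sym (occurrences-extras-< i d i<d)

  c≡binomialSum : ∀ j → j < d → entry c j ≡ binomialSum (attachments N) j
  c≡binomialSum = Equivalence.from (entry≡binomialSum⇔coeff≡occurrences c (attachments N) attachments<d) coeff≡occurrences

  clique-vector : IsCliqueVector G d c
  clique-vector = largest , bounded , λ j → trans (sym (entry-lookup c j))
                    (trans (c≡binomialSum (toℕ j) (FinP.toℕ<n j)) (sym (numCliques-G (toℕ j))))
    where
    d′ : ℕ
    d′ = Nat.pred d
    d≡ : suc d′ ≡ d
    d≡ = ℕP.suc-pred d {{Nat.>-nonZero 1≤d}}
    d′<d : d′ < d
    d′<d = ℕP.≤-reflexive d≡
    top-count : 0 < occurrences d′ (attachments N)
    top-count with subst (+ 0 <ℤ_) (coeff≡occurrences d′ d′<d) (positive d′ d′<d)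
    ... | +<+ pos = pos
    largest : Σ (Subset N) λ S → IsClique G S × ∣ S ∣ ≡ d
    largest = numCliques-pos⇒clique G d (subst (λ s → 0 < numCliques G s) d≡
                (subst (0 <_) (sym (numCliques-G d′))
                  (ℕP.<-≤-trans top-count (occurrences-≤-binomialSum d′ (attachments N)))))
    bounded : ∀ S → IsClique G S → ∣ S ∣ ≤ d
    bounded S S-clique with ∣ S ∣ in ∣S∣≡
    ... | zero  = z≤n
    ... | suc j with d Nat.≤? j
    ...   | no  d≰j = ℕP.≰⇒> d≰j
    ...   | yes d≤j = contradiction (subst (λ s → 0 < numCliques G s) ∣S∣≡ (clique⇒numCliques-pos G S S-clique))
                        (λ pos → ℕP.<-irrefl refl (subst (0 <_)
                           (trans (numCliques-G j) (binomialSum-above d (attachments N) attachments<d j d≤j)) pos))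

  realisation : Σ ℕ λ n → Σ (Graph n) λ G → Chordal G × KConnected k G × IsCliqueVector G d c
  realisation = N , G , chordal , k-connected k k≤d (All.map proj₁ bounds) , clique-vector

coeff-bPoly-clique-vector : ∀ k d {n} (G : Graph n) (c : Vec ℕ d) → Chordal G → KConnected k G → IsCliqueVector G d c →
  (∀ i → i < d → + 0 <ℤ coeff (bPoly c) i) × (∀ i → i < k → coeff (bPoly c) i ≡ + 1)
coeff-bPoly-clique-vector k d G c chordal connected cv with clique-vector-degrees k d G c chordal connected cv
... | (ms , bounds , k≤d , c≡) = positive , ones
  where
  all<d : All (_< d) (ms ++ downFrom d)
  all<d = AllP.++⁺ (All.map proj₂ bounds) (All-<-downFrom d)
  b≡ : ∀ i → i < d → coeff (bPoly c) i ≡ + suc (occurrences i ms)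
  b≡ i i<d = trans (Equivalence.to (entry≡binomialSum⇔coeff≡occurrences c (ms ++ downFrom d) all<d) c≡ i i<d)
    (cong +_ (trans (occurrences-++ i ms (downFrom d))
                    (trans (cong (λ o → occurrences i ms + o) (occurrences-downFrom i d i<d)) (ℕP.+-comm (occurrences i ms) 1))))
  positive : ∀ i → i < d → + 0 <ℤ coeff (bPoly c) i
  positive i i<d = subst (+ 0 <ℤ_) (sym (b≡ i i<d)) (+<+ (s≤s z≤n))
  ones : ∀ i → i < k → coeff (bPoly c) i ≡ + 1
  ones i i<k = trans (b≡ i (ℕP.<-≤-trans i<k k≤d))
    (cong (+_ ∘ suc) (occurrences-absent i ms (All.map (λ (k≤m , _) → ℕP.>⇒≢ (ℕP.<-≤-trans i<k k≤m)) bounds)))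

theorem1p1 : (k d : ℕ) → 1 ≤ d → (c : Vec ℕ d) →
    (Σ ℕ (λ n → Σ (Graph n) (λ G → Chordal G × KConnected k G × IsCliqueVector G d c)))
    ⇔ ((∀ i → i < d → + 0 <ℤ coeff (bPoly c) i) × (∀ i → i < k → coeff (bPoly c) i ≡ + 1))
theorem1p1 k d 1≤d c = mk⇔
  (λ (n , G , chordal , connected , cv) → coeff-bPoly-clique-vector k d G c chordal connected cv)
  (λ (positive , ones) → Realisation.realisation k d 1≤d c positive ones)
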